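{- For $n\ge0$ let $a_n=m_1(\mathrm{Im}\mathcal B_2(n))$ and $b_n=m_2(\mathrm{Im}\mathcal B_2(n))$. Then: (a) $\displaystyle\sum_{n\ge0}b_nq^n=\frac{q^3}{(1-q)(1-q^2)}\prod_{i\ge0}\frac1{1-q^{2^i}}$. (b) For $n\ge0$, $b_n=\sum_{i\ge1}\left\lfloor\frac{i-1}{2}\right\rfloor|\mathcal B(n-i)|$. (c) For $n\ge0$, $b_n=\sum_{i=0}^{\lfloor n/2\rfloor}\left\lfloor\frac{(n-1-2i)^2}{4}\right\rfloor|\mathcal B(i)|$. (d) For $n\ge0$, $(n-3)b_n=\sum_{k=1}^n\left(\beta(k)+(-1)^k+2\right)b_{n-k}$. (e) For $n\ge0$, $\Delta b_n=a_{\lfloor n/2\rfloor+1}$. (f) For $n\ge0$, $a_n=b_n+b_{n+1}$.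
   Context: A binary partition is a partition (weakly decreasing sequence of positive integers) all of whose parts are powers of $2$ (including $1$). $\mathcal B(n)$ is the set of binary partitions of $n$, with $\mathcal B(0)=\{\text{empty partition}\}$ and $\mathcal B(n)=\emptyset$ for $n<0$; $\mathcal B_2(n)$ is the set of those with at least two parts. For a partition $\lambda=(\lambda_1,\dots,\lambda_\ell)$ with $\ell\ge2$, $\mathrm{pre}_2(\lambda)$ is the partition whose parts are the products $\lambda_i\lambda_j$, $1\le i<j\le\ell$. $\mathrm{Im}\mathcal B_2(n)=\{\mathrm{pre}_2(\lambda):\lambda\in\mathcal B_2(n)\}$. $m_i(\mu)$ is the number of parts equal to $i$ in $\mu$ and, for a set $S$ of partitions, $m_i(S)=\sum_{\mu\in S}m_i(\mu)$. $\beta(k)=\sum_{2^i\mid k}2^i$. $\Delta b_n=b_{n+1}-b_n$. -}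

module Defs where

open import Data.Nat using (ℕ; zero; suc; _+_; _*_; _∸_; _^_; _≤?_; _≟_)
open import Data.Nat.Divisibility using (_∣?_)
open import Data.Nat.DivMod using (_/_)
open import Data.Integer as ℤ using (ℤ; ∣_∣) renaming (+_ to ⁺_)
import Data.List
open import Data.List using (List; []; _∷_; _++_; map; concatMap; length; upTo; replicate; applyUpTo; reverse; deduplicate; filter)
open import Data.Nat.ListAction using (sum)
open import Data.List.Properties using (≡-dec)
open import Relation.Nullary using (Dec; yes; no)
open import Relation.Nullary.Decidable using (does)
open import Data.Bool using (if_then_else_)

-- Partitions are represented as lists of positive integers in weakly
-- decreasing order.

Σ[_⋯_] : ℕ → ℕ → (ℕ → ℕ) → ℕ
Σ[ a ⋯ b ] f = sum (map (λ j → f (a + j)) (upTo (suc b ∸ a)))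

-- partsFrom ps n : all partitions of n whose parts are taken from the
-- list ps of allowed part sizes (ps given in decreasing order, all ≥ 1);
-- for each allowed part p we choose its multiplicity c with c*p ≤ n.
partsFrom : List ℕ → ℕ → List (List ℕ)
partsFrom [] zero = [] ∷ []
partsFrom [] (suc _) = []
partsFrom (p ∷ ps) n =
  concatMap (λ c → if does (c * p ≤? n)
                     then map (replicate c p ++_) (partsFrom ps (n ∸ c * p))
                     else [])
            (upTo (suc n))

-- allowed parts 2^n, 2^(n-1), ..., 2^1, 2^0 (every power of 2 that is ≤ n occurs)
powersDown : ℕ → List ℕ
powersDown n = reverse (applyUpTo (2 ^_) (suc n))

B : ℕ → List (List ℕ)
B n = partsFrom (powersDown n) n

B₂ : ℕ → List (List ℕ)
B₂ n = filter (λ λ' → 2 ≤? length λ') (B n)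

insertDesc : ℕ → List ℕ → List ℕ
insertDesc x [] = x ∷ []
insertDesc x (y ∷ ys) = if does (y ≤? x) then x ∷ y ∷ ys else y ∷ insertDesc x ys

sortDesc : List ℕ → List ℕ
sortDesc [] = []
sortDesc (x ∷ xs) = insertDesc x (sortDesc xs)

pairProducts : List ℕ → List ℕ
pairProducts [] = []
pairProducts (x ∷ xs) = map (x *_) xs ++ pairProducts xs

pre₂ : List ℕ → List ℕ
pre₂ λ' = sortDesc (pairProducts λ')

-- Im 𝓑₂(n) as a set: the image list with duplicates removed
ImB₂ : ℕ → List (List ℕ)
ImB₂ n = deduplicate (≡-dec _≟_) (map pre₂ (B₂ n))

m : ℕ → List ℕ → ℕ
m i μ = length (filter (_≟ i) μ)

mSet : ℕ → List (List ℕ) → ℕ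
mSet i S = sum (map (m i) S)

a : ℕ → ℕ
a n = mSet 1 (ImB₂ n)

b : ℕ → ℕ
b n = mSet 2 (ImB₂ n)

-- β(k) = Σ_{2^i ∣ k} 2^i  (for k ≥ 1 only i ≤ k can occur)
β : ℕ → ℕ
β k = Σ[ 0 ⋯ k ] (λ i → if does ((2 ^ i) ∣? k) then 2 ^ i else 0)

-- Formal power series with coefficients in ℕ: f n = coefficient of q^n

Series : Set
Series = ℕ → ℕ

_⊛_ : Series → Series → Series
(f ⊛ g) n = Σ[ 0 ⋯ n ] (λ k → f k * g (n ∸ k))

shift : ℕ → Series → Series
shift s f n = if does (s ≤? n) then f (n ∸ s) else 0

one : Series
one zero = 1
one (suc _) = 0

-- 1/(1 - q^k) = Σ_j q^{kj}  (for k ≥ 1)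
geomInv : ℕ → Series
geomInv k n = if does (k ∣? n) then 1 else 0

binProdUpTo : ℕ → Series
binProdUpTo zero = one
binProdUpTo (suc N) = binProdUpTo N ⊛ geomInv (2 ^ N)

-- infinite product Π_{i≥0} 1/(1 - q^{2^i}): the coefficient of q^n is
-- that of the finite product over i ≤ n (factors with 2^i > n are
-- ≡ 1 modulo q^{n+1}, so the coefficient has stabilised).
binProd : Series
binProd n = binProdUpTo (suc n) n

rhsA : Series
rhsA = shift 3 ((geomInv 1 ⊛ geomInv 2) ⊛ binProd)

sqTerm : ℕ → ℕ → ℕ
sqTerm n i = let d = ∣ (⁺ n) ℤ.- ⁺ 1 ℤ.- ⁺ (2 * i) ∣ in (d * d) / 4

sgn : ℕ → ℤ
sgn k = if does (2 ∣? k) then ⁺ 1 else ℤ.- ⁺ 1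

Σℤ[_⋯_] : ℕ → ℕ → (ℕ → ℤ) → ℤ
Σℤ[ a ⋯ b ] f = Data.List.foldr ℤ._+_ (⁺ 0) (map (λ j → f (a + j)) (upTo (suc b ∸ a)))

{-# OPTIONS --safe #-}
module Submission where

-- Write P(q) = Σ |𝓑(n)| qⁿ = ∏_{i≥0} 1/(1 - q^(2^i)). The parts equal to 1 or 2 of pre₂ λ are the
-- products 1·1 and 1·2, so m₁(pre₂ λ) = C(m₁ λ, 2) and m₂(pre₂ λ) = m₁ λ · m₂ λ. Moreover pre₂ is
-- injective on 𝓑(n), because pre₂ λ determines all power sums Σ λᵢ^(2^j) of λ. Hence a and b are
-- sums of these weights over 𝓑(n); since the weights only see the parts 1 and 2, the factors of P
-- for parts ≥ 4 split off and one gets b = q³P/((1 - q)(1 - q²)) and a = q²P/(1 - q)².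
-- The identities (a)–(f) follow from these and from P(q) = P(q²)/(1 - q); for (d) one also needs
-- q P'(q) = (Σ_{k≥1} β(k) qᵏ) P(q), proved by checking that both sides solve the functional equation
-- X(q) = q P(q)/(1 - q) + 2 X(q²)/(1 - q), which has only one solution.

open import Defs
open import Data.Nat
  using (ℕ; zero; suc; pred; _+_; _*_; _∸_; _^_; _≤_; _<_; _≥_; _>_; _≤?_; _<?_; _≟_; z≤n; s≤s; s≤s⁻¹;
         NonZero; >-nonZero; >-nonZero⁻¹)
open import Data.Nat.Properties
open import Data.Nat.DivMod
  using (_/_; m/n≡1+[m∸n]/n; +-distrib-/-∣ʳ; m*n/n≡m; m/n*n≤m; m/n≤m; m/n<m; /-monoˡ-≤; [m+kn]%n≡m%n)
open import Data.Nat.Divisibility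
  using (_∣_; _∣?_; divides; ∣m+n∣m⇒∣n; ∣m∣n⇒∣m+n; ∣-refl; ∣⇒≤; ∣-trans; m∣m*n; 1∣_; n∣m⇒m%n≡0;
         *-cancelˡ-∣; *-monoʳ-∣)
open import Data.Nat.Induction using (<-rec)
open import Data.Nat.ListAction using (sum)
open import Data.Nat.ListAction.Properties using (sum-++; sum-↭)
open import Data.Nat.Tactic.RingSolver using (solve-∀)
open import Data.Integer as ℤ using (ℤ) renaming (+_ to ⁺_)
import Data.Integer.Properties as ℤ
open import Data.Integer.Tactic.RingSolver using () renaming (solve-∀ to ℤ-solve-∀)
open import Data.Bool using (true; false; if_then_else_)
open import Data.Product using (_×_; _,_; ∃-syntax)
open import Data.Sum using (inj₁; inj₂)
open import Data.List
  using (List; []; _∷_; _++_; _∷ʳ_; map; foldr; concat; concatMap; applyUpTo; upTo; replicate; length; filter;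
         reverse; deduplicate)
open import Data.List.Properties
  using (map-id; map-∘; map-cong; map-++; map-applyUpTo; concat-map; ++-identityʳ; ∷-injectiveʳ; applyUpTo-∷ʳ;
         reverse-++; length-++; filter-++; filter-accept; filter-reject; filter-all; ≡-dec)
open import Data.List.Membership.Propositional using (_∈_)
open import Data.List.Membership.Propositional.Properties using (∈-map⁻)
open import Data.List.Relation.Unary.All as All using (All; []; _∷_)
open import Data.List.Relation.Unary.All.Properties using (++⁺; map⁺; filter⁺)
open import Data.List.Relation.Unary.AllPairs using (AllPairs; []; _∷_)
open import Data.List.Relation.Unary.Any using (here; there)
open import Data.List.Relation.Unary.Unique.Propositional using (Unique)
import Data.List.Relation.Unary.Unique.Propositional.Properties as Unique
open import Data.List.Relation.Binary.Disjoint.Propositional using (Disjoint)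
open import Data.List.Relation.Binary.Permutation.Propositional using (_↭_; ↭-refl; ↭-prep; ↭-swap; ↭-trans)
open import Data.List.Relation.Binary.Permutation.Propositional.Properties
  using (↭-length; filter-↭) renaming (map⁺ to ↭-map⁺)
open import Algebra.Bundles using (CommutativeMonoid)
open import Algebra.Properties.CommutativeSemigroup +-commutativeSemigroup
  using () renaming (interchange to +-interchange)
open import Function using (_∘_; id)
open import Function.Bundles using (_⇔_; mk⇔; Equivalence)
open import Relation.Binary.Bundles using (Setoid)
open import Relation.Binary.Definitions using (tri<; tri≈; tri>; DecidableEquality)
open import Relation.Binary.PropositionalEquality
import Relation.Binary.Reasoning.Setoid
open import Relation.Nullary using (¬_; contradiction; Dec; yes; no; does)
open import Relation.Nullary.Decidable using (dec-true; dec-false; does-⇔)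
open import Relation.Unary using (Decidable)

-- Formal power series

infixl 6 _⊕_
infixr 8 _⊙_
infixl 7 _⋆_

tail : Series → Series
tail f n = f (suc n)

_⊕_ : Series → Series → Series
(f ⊕ g) n = f n + g n

_⊙_ : ℕ → Series → Series
(c ⊙ f) n = c * f n

-- The Cauchy product by recursion on the degree; it agrees with _⊛_ (⊛≗⋆).
_⋆_ : Series → Series → Series
(f ⋆ g) zero = f 0 * g 0
(f ⋆ g) (suc n) = f 0 * g (suc n) + (tail f ⋆ g) n

⋆-congˡ : ∀ {f f'} g → f ≗ f' → f ⋆ g ≗ f' ⋆ g
⋆-congˡ g f≗f' zero = cong (_* g 0) (f≗f' 0)
⋆-congˡ g f≗f' (suc n) = cong₂ _+_ (cong (_* g (suc n)) (f≗f' 0)) (⋆-congˡ g (f≗f' ∘ suc) n)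

⋆-congʳ : ∀ f {g g'} → g ≗ g' → f ⋆ g ≗ f ⋆ g'
⋆-congʳ f g≗g' zero = cong (f 0 *_) (g≗g' 0)
⋆-congʳ f g≗g' (suc n) = cong₂ _+_ (cong (f 0 *_) (g≗g' (suc n))) (⋆-congʳ (tail f) g≗g' n)

⋆-cong : ∀ {f f' g g'} → f ≗ f' → g ≗ g' → f ⋆ g ≗ f' ⋆ g'
⋆-cong {f' = f'} {g} f≗f' g≗g' n = trans (⋆-congˡ g f≗f' n) (⋆-congʳ f' g≗g' n)

⋆-sucʳ : ∀ f g n → (f ⋆ g) (suc n) ≡ (f ⋆ tail g) n + f (suc n) * g 0
⋆-sucʳ f g zero = refl
⋆-sucʳ f g (suc n) = begin
    f 0 * g (suc (suc n)) + (tail f ⋆ g) (suc n)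
  ≡⟨ cong (f 0 * g (suc (suc n)) +_) (⋆-sucʳ (tail f) g n) ⟩
    f 0 * g (suc (suc n)) + ((tail f ⋆ tail g) n + f (suc (suc n)) * g 0)
  ≡⟨ +-assoc (f 0 * g (suc (suc n))) _ _ ⟨
    f 0 * g (suc (suc n)) + (tail f ⋆ tail g) n + f (suc (suc n)) * g 0 ∎
  where open ≡-Reasoning

⋆-comm : ∀ f g → f ⋆ g ≗ g ⋆ f
⋆-comm f g zero = *-comm (f 0) (g 0)
⋆-comm f g (suc n) = begin
    f 0 * g (suc n) + (tail f ⋆ g) n
  ≡⟨ cong₂ _+_ (*-comm (f 0) _) (⋆-comm (tail f) g n) ⟩
    g (suc n) * f 0 + (g ⋆ tail f) n
  ≡⟨ +-comm _ ((g ⋆ tail f) n) ⟩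
    (g ⋆ tail f) n + g (suc n) * f 0
  ≡⟨ ⋆-sucʳ g f n ⟨
    (g ⋆ f) (suc n) ∎
  where open ≡-Reasoning

⋆-distribʳ-⊕ : ∀ f f' g → (f ⊕ f') ⋆ g ≗ f ⋆ g ⊕ f' ⋆ g
⋆-distribʳ-⊕ f f' g zero = *-distribʳ-+ (g 0) (f 0) (f' 0)
⋆-distribʳ-⊕ f f' g (suc n) = trans
  (cong₂ _+_ (*-distribʳ-+ (g (suc n)) (f 0) (f' 0)) (⋆-distribʳ-⊕ (tail f) (tail f') g n))
  (+-interchange (f 0 * g (suc n)) _ _ _)

⋆-distribˡ-⊕ : ∀ f g g' → f ⋆ (g ⊕ g') ≗ f ⋆ g ⊕ f ⋆ g'
⋆-distribˡ-⊕ f g g' n = trans (⋆-comm f (g ⊕ g') n) (trans (⋆-distribʳ-⊕ g g' f n)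
  (cong₂ _+_ (⋆-comm g f n) (⋆-comm g' f n)))

⋆-⊙ˡ : ∀ c f g → (c ⊙ f) ⋆ g ≗ c ⊙ (f ⋆ g)
⋆-⊙ˡ c f g zero = *-assoc c (f 0) (g 0)
⋆-⊙ˡ c f g (suc n) = trans (cong₂ _+_ (*-assoc c (f 0) _) (⋆-⊙ˡ c (tail f) g n))
  (sym (*-distribˡ-+ c _ _))

⋆-⊙ʳ : ∀ c f g → f ⋆ (c ⊙ g) ≗ c ⊙ (f ⋆ g)
⋆-⊙ʳ c f g n = trans (⋆-comm f (c ⊙ g) n) (trans (⋆-⊙ˡ c g f n) (cong (c *_) (⋆-comm g f n)))

⋆-assoc : ∀ f g h → (f ⋆ g) ⋆ h ≗ f ⋆ (g ⋆ h)
⋆-assoc f g h zero = *-assoc (f 0) (g 0) (h 0)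
⋆-assoc f g h (suc n) = begin
    f 0 * g 0 * h (suc n) + (tail (f ⋆ g) ⋆ h) n
  ≡⟨ cong (f 0 * g 0 * h (suc n) +_) (⋆-distribʳ-⊕ (f 0 ⊙ tail g) (tail f ⋆ g) h n) ⟩
    f 0 * g 0 * h (suc n) + (((f 0 ⊙ tail g) ⋆ h) n + ((tail f ⋆ g) ⋆ h) n)
  ≡⟨ cong (f 0 * g 0 * h (suc n) +_) (cong₂ _+_ (⋆-⊙ˡ (f 0) (tail g) h n) (⋆-assoc (tail f) g h n)) ⟩
    f 0 * g 0 * h (suc n) + (f 0 * (tail g ⋆ h) n + (tail f ⋆ (g ⋆ h)) n)
  ≡⟨ regroup (f 0) (g 0) (h (suc n)) _ _ ⟩
    f 0 * (g 0 * h (suc n) + (tail g ⋆ h) n) + (tail f ⋆ (g ⋆ h)) n ∎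
  where
  open ≡-Reasoning
  regroup : ∀ a b c d e → a * b * c + (a * d + e) ≡ a * (b * c + d) + e
  regroup = solve-∀

⋆-identityˡ : ∀ g → one ⋆ g ≗ g
⋆-identityˡ g zero = +-identityʳ (g 0)
⋆-identityˡ g (suc n) = trans (cong (g (suc n) + 0 +_) (zero⋆ g n)) (trans (+-identityʳ _) (+-identityʳ _))
  where
  zero⋆ : ∀ g n → ((λ _ → 0) ⋆ g) n ≡ 0
  zero⋆ g zero = refl
  zero⋆ g (suc n) = zero⋆ g n

⋆-identityʳ : ∀ f → f ⋆ one ≗ f
⋆-identityʳ f n = trans (⋆-comm f one n) (⋆-identityˡ f n)

⋆-commutativeMonoid : CommutativeMonoid _ _
⋆-commutativeMonoid = record
  { Carrier = Series
  ; _≈_ = _≗_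
  ; _∙_ = _⋆_
  ; ε = one
  ; isCommutativeMonoid = record
    { isMonoid = record
      { isSemigroup = record
        { isMagma = record
          { isEquivalence = Setoid.isEquivalence (ℕ →-setoid ℕ)
          ; ∙-cong = ⋆-cong
          }
        ; assoc = ⋆-assoc
        }
      ; identity = ⋆-identityˡ , ⋆-identityʳ
      }
    ; comm = ⋆-comm
    }
  }

open import Algebra.Solver.CommutativeMonoid ⋆-commutativeMonoid using (solve; _⊜_)
  renaming (_⊕_ to _⊗_)

module ≗-Reasoning = Relation.Binary.Reasoning.Setoid (ℕ →-setoid ℕ)
open Setoid (ℕ →-setoid ℕ) using () renaming (refl to ≗-refl; sym to ≗-sym; trans to ≗-trans)

infixr 8 q^_·_

q^_·_ : ℕ → Series → Series
(q^ zero · f) n = f n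
(q^ suc p · f) zero = 0
(q^ suc p · f) (suc n) = (q^ p · f) n

ones : Series
ones _ = 1

q^·-cong : ∀ p {f g} → f ≗ g → q^ p · f ≗ q^ p · g
q^·-cong zero f≗g n = f≗g n
q^·-cong (suc p) f≗g zero = refl
q^·-cong (suc p) f≗g (suc n) = q^·-cong p f≗g n

q^·-⊕ : ∀ p f g → q^ p · (f ⊕ g) ≗ q^ p · f ⊕ q^ p · g
q^·-⊕ zero f g n = refl
q^·-⊕ (suc p) f g zero = refl
q^·-⊕ (suc p) f g (suc n) = q^·-⊕ p f g n

q^·-+ : ∀ p f m → (q^ p · f) (p + m) ≡ f m
q^·-+ zero f m = refl
q^·-+ (suc p) f m = q^·-+ p f m

q^·-< : ∀ p f {n} → n < p → (q^ p · f) n ≡ 0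
q^·-< (suc p) f {zero} _ = refl
q^·-< (suc p) f {suc n} (s≤s n<p) = q^·-< p f n<p

q^·-q^· : ∀ p r f → q^ p · q^ r · f ≗ q^ (p + r) · f
q^·-q^· zero r f n = refl
q^·-q^· (suc p) r f zero = refl
q^·-q^· (suc p) r f (suc n) = q^·-q^· p r f n

⋆-q^·ˡ : ∀ p f g → (q^ p · f) ⋆ g ≗ q^ p · (f ⋆ g)
⋆-q^·ˡ zero f g n = refl
⋆-q^·ˡ (suc p) f g zero = refl
⋆-q^·ˡ (suc p) f g (suc n) = ⋆-q^·ˡ p f g n

⋆-q^·ʳ : ∀ p f g → f ⋆ (q^ p · g) ≗ q^ p · (f ⋆ g)
⋆-q^·ʳ p f g n = trans (⋆-comm f (q^ p · g) n) (trans (⋆-q^·ˡ p g f n) (q^·-cong p (⋆-comm g f) n))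

ones-⋆-suc : ∀ f n → (ones ⋆ f) (suc n) ≡ f (suc n) + (ones ⋆ f) n
ones-⋆-suc f n = cong (_+ (ones ⋆ f) n) (+-identityʳ (f (suc n)))

AgreeUpTo : ℕ → Series → Series → Set
AgreeUpTo n f g = ∀ {k} → k ≤ n → f k ≡ g k

⋆-agreeʳ : ∀ f {g g'} n → AgreeUpTo n g g' → (f ⋆ g) n ≡ (f ⋆ g') n
⋆-agreeʳ f zero g≈g' = cong (f 0 *_) (g≈g' z≤n)
⋆-agreeʳ f (suc n) g≈g' =
  cong₂ _+_ (cong (f 0 *_) (g≈g' ≤-refl)) (⋆-agreeʳ (tail f) n (g≈g' ∘ m≤n⇒m≤1+n))

⋆-agreeˡ : ∀ {f f'} g n → AgreeUpTo n f f' → (f ⋆ g) n ≡ (f' ⋆ g) n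
⋆-agreeˡ {f} {f'} g n f≈f' = trans (⋆-comm f g n) (trans (⋆-agreeʳ g n f≈f') (⋆-comm g f' n))

q^·-agree : ∀ p {f g} n → AgreeUpTo n f g → (q^ p · f) n ≡ (q^ p · g) n
q^·-agree zero n f≈g = f≈g ≤-refl
q^·-agree (suc p) zero f≈g = refl
q^·-agree (suc p) (suc n) f≈g = q^·-agree p n (f≈g ∘ m≤n⇒m≤1+n)

data BelowOrAbove (p : ℕ) : ℕ → Set where
  below : ∀ {n} → n < p → BelowOrAbove p n
  above : ∀ k → BelowOrAbove p (p + k)

belowOrAbove : ∀ p n → BelowOrAbove p n
belowOrAbove p n with n <? p
... | yes n<p = below n<p
... | no n≮p = subst (BelowOrAbove p) (m+[n∸m]≡n (≮⇒≥ n≮p)) (above (n ∸ p))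

-- Each coefficient of a solution is determined by strictly earlier ones.
q^·-fixpoint-unique : ∀ p h {f g} → f ≗ h ⊕ q^ suc p · f → g ≗ h ⊕ q^ suc p · g → f ≗ g
q^·-fixpoint-unique p h {f} {g} f-eq g-eq n = agree n ≤-refl
  where
  agree : ∀ n → AgreeUpTo n f g
  agree n {zero} _ = trans (f-eq 0) (sym (g-eq 0))
  agree (suc n) {suc k} (s≤s k≤n) = trans (f-eq (suc k)) (trans
    (cong (h (suc k) +_) (q^·-agree p k (agree n ∘ (λ j≤k → ≤-trans j≤k k≤n))))
    (sym (g-eq (suc k))))

geomInv-zero : ∀ p → geomInv p 0 ≡ 1
geomInv-zero p = cong (if_then 1 else 0) (dec-true (p ∣? 0) (divides 0 refl))

geomInv-< : ∀ p {n} → 0 < n → n < p → geomInv p n ≡ 0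
geomInv-< p {n} 0<n n<p = cong (if_then 1 else 0)
  (dec-false (p ∣? n) (λ p∣n → <⇒≱ n<p (∣⇒≤ {{>-nonZero 0<n}} p∣n)))

geomInv-periodic : ∀ p m → geomInv p (p + m) ≡ geomInv p m
geomInv-periodic p m with p ∣? m
... | yes p∣m = cong (if_then 1 else 0) (dec-true (p ∣? (p + m)) (∣m∣n⇒∣m+n ∣-refl p∣m))
... | no p∤m = cong (if_then 1 else 0) (dec-false (p ∣? (p + m)) (λ p∣p+m → p∤m (∣m+n∣m⇒∣n p∣p+m ∣-refl)))

geomInv-fixpoint : ∀ p → geomInv (suc p) ≗ one ⊕ q^ suc p · geomInv (suc p)
geomInv-fixpoint p n with belowOrAbove (suc p) n
geomInv-fixpoint p .0 | below {zero} _ = geomInv-zero (suc p)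
geomInv-fixpoint p .(suc n) | below {suc n} n<p = trans (geomInv-< (suc p) (s≤s z≤n) n<p) (sym (q^·-< (suc p) _ n<p))
geomInv-fixpoint p .(suc p + k) | above k =
  trans (geomInv-periodic (suc p) k) (sym (q^·-+ (suc p) (geomInv (suc p)) k))

geomInv-⋆-fixpoint : ∀ p h → geomInv (suc p) ⋆ h ≗ h ⊕ q^ suc p · (geomInv (suc p) ⋆ h)
geomInv-⋆-fixpoint p h = begin
    geomInv (suc p) ⋆ h
  ≈⟨ ⋆-congˡ h (geomInv-fixpoint p) ⟩
    (one ⊕ q^ suc p · geomInv (suc p)) ⋆ h
  ≈⟨ ⋆-distribʳ-⊕ one _ h ⟩
    one ⋆ h ⊕ (q^ suc p · geomInv (suc p)) ⋆ h
  ≈⟨ (λ n → cong₂ _+_ (⋆-identityˡ h n) (⋆-q^·ˡ (suc p) (geomInv (suc p)) h n)) ⟩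
    h ⊕ q^ suc p · (geomInv (suc p) ⋆ h) ∎
  where open ≗-Reasoning

geomInv-⋆-below : ∀ p h .{{_ : NonZero p}} {k} → k < p → (geomInv p ⋆ h) k ≡ h k
geomInv-⋆-below (suc p) h {k} k<p = trans (geomInv-⋆-fixpoint p h k)
  (trans (cong (h k +_) (q^·-< (suc p) _ k<p)) (+-identityʳ _))

solve-geomInv : ∀ p h {f} → f ≗ h ⊕ q^ suc p · f → f ≗ geomInv (suc p) ⋆ h
solve-geomInv p h f-eq = q^·-fixpoint-unique p h f-eq (geomInv-⋆-fixpoint p h)

-- The substitution q ↦ q² and the operator θ

data EvenOdd : ℕ → Set where
  even : ∀ j → EvenOdd (j + j)
  odd : ∀ j → EvenOdd (suc (j + j))

evenOdd : ∀ n → EvenOdd n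
evenOdd zero = even 0
evenOdd (suc n) with evenOdd n
... | even j = odd j
... | odd j = subst EvenOdd (cong suc (+-suc j j)) (even (suc j))

[2+n]/2≡1+n/2 : ∀ n → suc (suc n) / 2 ≡ suc (n / 2)
[2+n]/2≡1+n/2 n = m/n≡1+[m∸n]/n {suc (suc n)} (s≤s (s≤s z≤n))

[j+j]/2≡j : ∀ j → (j + j) / 2 ≡ j
[j+j]/2≡j zero = refl
[j+j]/2≡j (suc j) = trans (cong (λ n → suc n / 2) (+-suc j j))
  (trans ([2+n]/2≡1+n/2 (j + j)) (cong suc ([j+j]/2≡j j)))

[1+j+j]/2≡j : ∀ j → suc (j + j) / 2 ≡ j
[1+j+j]/2≡j zero = refl
[1+j+j]/2≡j (suc j) = trans (cong (λ n → suc (suc n) / 2) (+-suc j j))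
  (trans ([2+n]/2≡1+n/2 (suc (j + j))) (cong suc ([1+j+j]/2≡j j)))

j+j≡2*j : ∀ j → j + j ≡ 2 * j
j+j≡2*j j = cong (j +_) (sym (+-identityʳ j))

infixl 9 _⟨q²⟩

_⟨q²⟩ : Series → Series
(f ⟨q²⟩) zero = f 0
(f ⟨q²⟩) (suc zero) = 0
(f ⟨q²⟩) (suc (suc n)) = (tail f ⟨q²⟩) n

⟨q²⟩-even : ∀ f j → (f ⟨q²⟩) (j + j) ≡ f j
⟨q²⟩-even f zero = refl
⟨q²⟩-even f (suc j) = trans (cong (λ n → (f ⟨q²⟩) (suc n)) (+-suc j j)) (⟨q²⟩-even (tail f) j)

⟨q²⟩-odd : ∀ f j → (f ⟨q²⟩) (suc (j + j)) ≡ 0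
⟨q²⟩-odd f zero = refl
⟨q²⟩-odd f (suc j) = trans (cong (λ n → (f ⟨q²⟩) (suc (suc n))) (+-suc j j)) (⟨q²⟩-odd (tail f) j)

⟨q²⟩-agree : ∀ {f g} n → AgreeUpTo (n / 2) f g → (f ⟨q²⟩) n ≡ (g ⟨q²⟩) n
⟨q²⟩-agree {f} {g} n f≈g with evenOdd n
... | even j = trans (⟨q²⟩-even f j) (trans (f≈g (≤-reflexive (sym ([j+j]/2≡j j)))) (sym (⟨q²⟩-even g j)))
... | odd j = trans (⟨q²⟩-odd f j) (sym (⟨q²⟩-odd g j))

⟨q²⟩-cong : ∀ {f g} → f ≗ g → f ⟨q²⟩ ≗ g ⟨q²⟩
⟨q²⟩-cong f≗g n = ⟨q²⟩-agree n (λ {k} _ → f≗g k)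

⟨q²⟩-⊕ : ∀ f g → (f ⊕ g) ⟨q²⟩ ≗ f ⟨q²⟩ ⊕ g ⟨q²⟩
⟨q²⟩-⊕ f g zero = refl
⟨q²⟩-⊕ f g (suc zero) = refl
⟨q²⟩-⊕ f g (suc (suc n)) = ⟨q²⟩-⊕ (tail f) (tail g) n

⟨q²⟩-⊙ : ∀ c f → (c ⊙ f) ⟨q²⟩ ≗ c ⊙ f ⟨q²⟩
⟨q²⟩-⊙ c f zero = refl
⟨q²⟩-⊙ c f (suc zero) = sym (*-zeroʳ c)
⟨q²⟩-⊙ c f (suc (suc n)) = ⟨q²⟩-⊙ c (tail f) n

⟨q²⟩-⋆ : ∀ f g → (f ⋆ g) ⟨q²⟩ ≗ f ⟨q²⟩ ⋆ g ⟨q²⟩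
⟨q²⟩-⋆ f g zero = refl
⟨q²⟩-⋆ f g (suc zero) = sym (trans (+-identityʳ _) (*-zeroʳ (f 0)))
⟨q²⟩-⋆ f g (suc (suc n)) = begin
    ((f 0 ⊙ tail g ⊕ tail f ⋆ g) ⟨q²⟩) n
  ≡⟨ ⟨q²⟩-⊕ (f 0 ⊙ tail g) (tail f ⋆ g) n ⟩
    ((f 0 ⊙ tail g) ⟨q²⟩) n + ((tail f ⋆ g) ⟨q²⟩) n
  ≡⟨ cong₂ _+_ (⟨q²⟩-⊙ (f 0) (tail g) n) (⟨q²⟩-⋆ (tail f) g n) ⟩
    f 0 * (tail g ⟨q²⟩) n + (tail f ⟨q²⟩ ⋆ g ⟨q²⟩) n ∎
  where open ≡-Reasoning

⟨q²⟩-one : one ⟨q²⟩ ≗ one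
⟨q²⟩-one zero = refl
⟨q²⟩-one (suc zero) = refl
⟨q²⟩-one (suc (suc n)) = zero⟨q²⟩ n
  where
  zero⟨q²⟩ : ∀ n → ((λ _ → 0) ⟨q²⟩) n ≡ 0
  zero⟨q²⟩ zero = refl
  zero⟨q²⟩ (suc zero) = refl
  zero⟨q²⟩ (suc (suc n)) = zero⟨q²⟩ n

⟨q²⟩-q^· : ∀ p f → (q^ p · f) ⟨q²⟩ ≗ q^ (p + p) · f ⟨q²⟩
⟨q²⟩-q^· zero f n = refl
⟨q²⟩-q^· (suc p) f zero = refl
⟨q²⟩-q^· (suc p) f (suc zero) = sym (q^·-< (p + suc p) (f ⟨q²⟩) (≤-trans (s≤s z≤n) (m≤n+m (suc p) p)))
⟨q²⟩-q^· (suc p) f (suc (suc n)) = trans (⟨q²⟩-q^· p f n)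
  (cong (λ r → (q^ r · f ⟨q²⟩) (suc n)) (sym (+-suc p p)))

⟨q²⟩-geomInv : ∀ p .{{_ : NonZero p}} → geomInv p ⟨q²⟩ ≗ geomInv (p + p)
⟨q²⟩-geomInv (suc p) = q^·-fixpoint-unique (p + suc p) one fixpoint (geomInv-fixpoint (p + suc p))
  where
  fixpoint : geomInv (suc p) ⟨q²⟩ ≗ one ⊕ q^ (suc p + suc p) · geomInv (suc p) ⟨q²⟩
  fixpoint n = trans (⟨q²⟩-cong (geomInv-fixpoint p) n) (trans (⟨q²⟩-⊕ one _ n)
    (cong₂ _+_ (⟨q²⟩-one n) (⟨q²⟩-q^· (suc p) (geomInv (suc p)) n)))

⟨q²⟩-⊕-q· : ∀ f n → (f ⟨q²⟩ ⊕ q^ 1 · f ⟨q²⟩) n ≡ f (n / 2)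
⟨q²⟩-⊕-q· f n with evenOdd n
⟨q²⟩-⊕-q· f .(j + j) | even j =
  trans (cong₂ _+_ (⟨q²⟩-even f j) (q·⟨q²⟩-even j)) (trans (+-identityʳ _) (cong f (sym ([j+j]/2≡j j))))
  where
  q·⟨q²⟩-even : ∀ j → (q^ 1 · f ⟨q²⟩) (j + j) ≡ 0
  q·⟨q²⟩-even zero = refl
  q·⟨q²⟩-even (suc j) = trans (cong (λ n → (q^ 1 · f ⟨q²⟩) (suc n)) (+-suc j j)) (⟨q²⟩-odd f j)
⟨q²⟩-⊕-q· f .(suc (j + j)) | odd j =
  trans (cong₂ _+_ (⟨q²⟩-odd f j) (⟨q²⟩-even f j)) (cong f (sym ([1+j+j]/2≡j j)))

-- θ = q d/dq
θ : Series → Series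
θ f n = n * f n

θ-cong : ∀ {f g} → f ≗ g → θ f ≗ θ g
θ-cong f≗g n = cong (n *_) (f≗g n)

θ-⋆ : ∀ f g → θ (f ⋆ g) ≗ θ f ⋆ g ⊕ f ⋆ θ g
θ-⋆ f g zero = sym (*-zeroʳ (f 0))
θ-⋆ f g (suc n) = begin
    suc n * (f 0 * g (suc n) + c)
  ≡⟨ expand n (f 0) (g (suc n)) c ⟩
    c + n * c + f 0 * (suc n * g (suc n))
  ≡⟨ cong (λ x → c + x + f 0 * (suc n * g (suc n))) (θ-⋆ (tail f) g n) ⟩
    c + (d + e) + f 0 * (suc n * g (suc n))
  ≡⟨ regroup c d e _ ⟩
    (c + d) + (f 0 * (suc n * g (suc n)) + e)
  ≡⟨ cong (_+ (f 0 * (suc n * g (suc n)) + e)) (⋆-distribʳ-⊕ (tail f) (θ (tail f)) g n) ⟨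
    ((tail f ⊕ θ (tail f)) ⋆ g) n + (f 0 * (suc n * g (suc n)) + e) ∎
  where
  open ≡-Reasoning
  c : ℕ
  c = (tail f ⋆ g) n
  d : ℕ
  d = (θ (tail f) ⋆ g) n
  e : ℕ
  e = (tail f ⋆ θ g) n
  expand : ∀ n a b c → (1 + n) * (a * b + c) ≡ c + n * c + a * ((1 + n) * b)
  expand = solve-∀
  regroup : ∀ c d e x → c + (d + e) + x ≡ (c + d) + (x + e)
  regroup = solve-∀

θ-q^· : ∀ p f → θ (q^ p · f) ≗ q^ p · θ f ⊕ p ⊙ q^ p · f
θ-q^· zero f n = sym (+-identityʳ _)
θ-q^· (suc p) f zero = sym (*-zeroʳ p)
θ-q^· (suc p) f (suc n) = begin
    suc n * (q^ p · f) n
  ≡⟨ +-comm ((q^ p · f) n) _ ⟩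
    n * (q^ p · f) n + (q^ p · f) n
  ≡⟨ cong (_+ (q^ p · f) n) (θ-q^· p f n) ⟩
    (q^ p · θ f) n + p * (q^ p · f) n + (q^ p · f) n
  ≡⟨ regroup ((q^ p · θ f) n) p ((q^ p · f) n) ⟩
    (q^ p · θ f) n + suc p * (q^ p · f) n ∎
  where
  open ≡-Reasoning
  regroup : ∀ a p x → a + p * x + x ≡ a + (1 + p) * x
  regroup = solve-∀

θ-⟨q²⟩ : ∀ f → θ (f ⟨q²⟩) ≗ 2 ⊙ θ f ⟨q²⟩
θ-⟨q²⟩ f n with evenOdd n
... | even j = trans (cong ((j + j) *_) (⟨q²⟩-even f j))
  (trans (double j (f j)) (sym (cong (2 *_) (⟨q²⟩-even (θ f) j))))
  where
  double : ∀ j x → (j + j) * x ≡ 2 * (j * x)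
  double = solve-∀
... | odd j = trans (cong (suc (j + j) *_) (⟨q²⟩-odd f j))
  (trans (*-zeroʳ (suc (j + j))) (sym (cong (2 *_) (⟨q²⟩-odd (θ f) j))))

θ-geomInv : ∀ p → θ (geomInv (suc p)) ≗ geomInv (suc p) ⋆ (suc p ⊙ q^ suc p · geomInv (suc p))
θ-geomInv p = solve-geomInv p _ fixpoint
  where
  G : Series
  G = geomInv (suc p)
  fixpoint : θ G ≗ suc p ⊙ q^ suc p · G ⊕ q^ suc p · θ G
  fixpoint n with belowOrAbove (suc p) n
  fixpoint .0 | below {zero} _ = sym (trans (+-identityʳ _) (*-zeroʳ (suc p)))
  fixpoint .(suc n) | below {suc n} n<p = trans (cong (suc n *_) (geomInv-< (suc p) (s≤s z≤n) n<p))
    (trans (*-zeroʳ (suc n)) (sym (trans (cong₂ _+_ (cong (suc p *_) (q^·-< (suc p) G n<p)) (q^·-< (suc p) (θ G) n<p))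
      (trans (+-identityʳ _) (*-zeroʳ (suc p))))))
  fixpoint .(suc p + k) | above k = begin
      (suc p + k) * G (suc p + k)
    ≡⟨ cong ((suc p + k) *_) (geomInv-periodic (suc p) k) ⟩
      (suc p + k) * G k
    ≡⟨ *-distribʳ-+ (G k) (suc p) k ⟩
      suc p * G k + k * G k
    ≡⟨ cong₂ (λ x y → suc p * x + y) (q^·-+ (suc p) G k) (q^·-+ (suc p) (θ G) k) ⟨
      suc p * (q^ suc p · G) (suc p + k) + (q^ suc p · θ G) (suc p + k) ∎
    where open ≡-Reasoning

-- Coefficient n of the right-hand side only involves f up to ⌊n/2⌋; at n = 0 the equation reads f₀ = h₀ + 2f₀.
⟨q²⟩-fixpoint-unique : ∀ h {f g} → f ≗ h ⊕ 2 ⊙ (ones ⋆ f ⟨q²⟩) → g ≗ h ⊕ 2 ⊙ (ones ⋆ g ⟨q²⟩) → f ≗ g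
⟨q²⟩-fixpoint-unique h {f} {g} f-eq g-eq n = agree n ≤-refl
  where
  x≡a+2x⇒x≡0 : ∀ {x} a → x ≡ a + 2 * (1 * x) → x ≡ 0
  x≡a+2x⇒x≡0 {zero} a _ = refl
  x≡a+2x⇒x≡0 {suc x} a eq = contradiction (≤-reflexive (sym eq)) (<⇒≱ (x<a+2x a))
    where
    x<a+2x : ∀ a → suc x < a + 2 * (1 * suc x)
    x<a+2x a = <-≤-trans (m<m+n (suc x) (s≤s z≤n)) (≤-trans (≤-reflexive (regroup x)) (m≤n+m _ a))
      where
      regroup : ∀ x → suc x + suc x ≡ 2 * (1 * suc x)
      regroup = solve-∀
  agree : ∀ n → AgreeUpTo n f g
  agree n {zero} _ = trans (x≡a+2x⇒x≡0 (h 0) (f-eq 0)) (sym (x≡a+2x⇒x≡0 (h 0) (g-eq 0)))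
  agree (suc n) {suc k} (s≤s k≤n) = trans (f-eq (suc k)) (trans
    (cong (λ x → h (suc k) + 2 * x) (⋆-agreeʳ ones (suc k) (λ {j} j≤1+k → ⟨q²⟩-agree j (λ i≤j/2 →
      agree n (≤-trans i≤j/2 (≤-trans (j/2≤k j≤1+k) k≤n))))))
    (sym (g-eq (suc k))))
    where
    j/2≤k : ∀ {j} → j ≤ suc k → j / 2 ≤ k
    j/2≤k j≤1+k = ≤-trans (/-monoˡ-≤ 2 j≤1+k) (s≤s⁻¹ (m/n<m (suc k) 2 (s≤s (s≤s z≤n))))

sum-upTo-suc : ∀ h n → sum (map h (upTo (suc n))) ≡ h 0 + sum (map (h ∘ suc) (upTo n))
sum-upTo-suc h n = cong (h 0 +_) (cong sum (trans (map-applyUpTo suc h n) (sym (map-applyUpTo id (h ∘ suc) n))))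

sum-upTo-cong : ∀ n {h h'} → (∀ {i} → i < n → h i ≡ h' i) → sum (map h (upTo n)) ≡ sum (map h' (upTo n))
sum-upTo-cong zero h≗h' = refl
sum-upTo-cong (suc n) {h} {h'} h≗h' = trans (sum-upTo-suc h n)
  (trans (cong₂ _+_ (h≗h' (s≤s z≤n)) (sum-upTo-cong n (h≗h' ∘ s≤s))) (sym (sum-upTo-suc h' n)))

sum-upTo-* : ∀ c h n → sum (map (λ i → c * h i) (upTo n)) ≡ c * sum (map h (upTo n))
sum-upTo-* c h zero = sym (*-zeroʳ c)
sum-upTo-* c h (suc n) = begin
    sum (map (λ i → c * h i) (upTo (suc n)))
  ≡⟨ sum-upTo-suc (λ i → c * h i) n ⟩
    c * h 0 + sum (map (λ i → c * h (suc i)) (upTo n))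
  ≡⟨ cong (c * h 0 +_) (sum-upTo-* c (h ∘ suc) n) ⟩
    c * h 0 + c * sum (map (h ∘ suc) (upTo n))
  ≡⟨ *-distribˡ-+ c _ _ ⟨
    c * (h 0 + sum (map (h ∘ suc) (upTo n)))
  ≡⟨ cong (c *_) (sum-upTo-suc h n) ⟨
    c * sum (map h (upTo (suc n))) ∎
  where open ≡-Reasoning

sum-upTo-truncate : ∀ h n r → (∀ i → h (n + i) ≡ 0) → sum (map h (upTo (n + r))) ≡ sum (map h (upTo n))
sum-upTo-truncate h zero zero _ = refl
sum-upTo-truncate h zero (suc r) h≡0 =
  trans (sum-upTo-suc h r) (cong₂ _+_ (h≡0 0) (sum-upTo-truncate (h ∘ suc) 0 r (h≡0 ∘ suc)))
sum-upTo-truncate h (suc n) r h≡0 = trans (sum-upTo-suc h (n + r))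
  (trans (cong (h 0 +_) (sum-upTo-truncate (h ∘ suc) n r h≡0)) (sym (sum-upTo-suc h n)))

⋆≗Σ : ∀ f g n → (f ⋆ g) n ≡ Σ[ 0 ⋯ n ] (λ k → f k * g (n ∸ k))
⋆≗Σ f g zero = sym (+-identityʳ _)
⋆≗Σ f g (suc n) = trans (cong (f 0 * g (suc n) +_) (⋆≗Σ (tail f) g n))
  (sym (sum-upTo-suc (λ k → f k * g (suc n ∸ k)) (suc n)))

⟨q²⟩-⋆≗Σ : ∀ g f n → (g ⟨q²⟩ ⋆ f) n ≡ Σ[ 0 ⋯ n / 2 ] (λ i → g i * f (n ∸ (i + i)))
⟨q²⟩-⋆≗Σ g f zero = sym (+-identityʳ _)
⟨q²⟩-⋆≗Σ g f (suc zero) = refl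
⟨q²⟩-⋆≗Σ g f (suc (suc n)) = begin
    g 0 * f (2 + n) + (tail g ⟨q²⟩ ⋆ f) n
  ≡⟨ cong (g 0 * f (2 + n) +_) (⟨q²⟩-⋆≗Σ (tail g) f n) ⟩
    g 0 * f (2 + n) + sum (map (λ i → g (suc i) * f (n ∸ (i + i))) (upTo (suc (n / 2))))
  ≡⟨ cong (g 0 * f (2 + n) +_)
       (sum-upTo-cong (suc (n / 2)) (λ {i} _ → cong (λ k → g (suc i) * f (suc n ∸ k)) (sym (+-suc i i)))) ⟩
    g 0 * f (2 + n) + sum (map (λ i → g (suc i) * f (2 + n ∸ (suc i + suc i))) (upTo (suc (n / 2))))
  ≡⟨ sum-upTo-suc (λ i → g i * f (2 + n ∸ (i + i))) (suc (n / 2)) ⟨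
    sum (map (λ i → g i * f (2 + n ∸ (i + i))) (upTo (2 + n / 2)))
  ≡⟨ cong (λ k → sum (map (λ i → g i * f (2 + n ∸ (i + i))) (upTo (suc k)))) ([2+n]/2≡1+n/2 n) ⟨
    Σ[ 0 ⋯ (2 + n) / 2 ] (λ i → g i * f (2 + n ∸ (i + i))) ∎
  where open ≡-Reasoning

⊛≗⋆ : ∀ f g → f ⊛ g ≗ f ⋆ g
⊛≗⋆ f g n = sym (⋆≗Σ f g n)

shift≗q^· : ∀ s f → shift s f ≗ q^ s · f
shift≗q^· s f n with s ≤? n
... | yes s≤n = trans (cong (if_then f (n ∸ s) else 0) (dec-true (s ≤? n) s≤n))
  (trans (sym (q^·-+ s f (n ∸ s))) (cong (q^ s · f) (m+[n∸m]≡n s≤n)))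
... | no s≰n = trans (cong (if_then f (n ∸ s) else 0) (dec-false (s ≤? n) s≰n)) (sym (q^·-< s f (≰⇒> s≰n)))

⁺-sum : ∀ {A : Set} (h : A → ℕ) xs → ⁺ sum (map h xs) ≡ foldr ℤ._+_ (⁺ 0) (map (λ x → ⁺ h x) xs)
⁺-sum h [] = refl
⁺-sum h (x ∷ xs) = trans (ℤ.pos-+ (h x) _) (cong (ℤ._+_ (⁺ h x)) (⁺-sum h xs))

-- Partitions with parts from a given list

withCopies : ℕ → List ℕ → ℕ → ℕ → List (List ℕ)
withCopies p ps n c = if does (c * p ≤? n) then map (replicate c p ++_) (partsFrom ps (n ∸ c * p)) else []

private
  concatMap-applyUpTo-cong : ∀ {A : Set} {g g' : ℕ → List A} k f f' → (∀ i → g (f i) ≡ g' (f' i)) →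
                             concatMap g (applyUpTo f k) ≡ concatMap g' (applyUpTo f' k)
  concatMap-applyUpTo-cong zero f f' eq = refl
  concatMap-applyUpTo-cong (suc k) f f' eq =
    cong₂ _++_ (eq 0) (concatMap-applyUpTo-cong k (f ∘ suc) (f' ∘ suc) (eq ∘ suc))

  concatMap-applyUpTo-truncate : ∀ {A : Set} {g : ℕ → List A} k r f → (∀ i → g (f (k + i)) ≡ []) →
                                 concatMap g (applyUpTo f (k + r)) ≡ concatMap g (applyUpTo f k)
  concatMap-applyUpTo-truncate zero zero f empty = refl
  concatMap-applyUpTo-truncate zero (suc r) f empty =
    cong₂ _++_ (empty 0) (concatMap-applyUpTo-truncate zero r (f ∘ suc) (empty ∘ suc))
  concatMap-applyUpTo-truncate (suc k) r f empty =
    cong (_ ++_) (concatMap-applyUpTo-truncate k r (f ∘ suc) empty)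

  concatMap-map : ∀ {A B : Set} (h : A → B) (g : ℕ → List A) l → concatMap (map h ∘ g) l ≡ map h (concatMap g l)
  concatMap-map h g l = trans (cong concat (map-∘ l)) (concat-map (map g l))

withCopies-zero : ∀ p ps n → withCopies p ps n 0 ≡ partsFrom ps n
withCopies-zero p ps n = map-id (partsFrom ps n)

withCopies-tooMany : ∀ p ps {n} c → n < c * p → withCopies p ps n c ≡ []
withCopies-tooMany p ps {n} c n<cp rewrite dec-false (c * p ≤? n) (<⇒≱ n<cp) = refl

withCopies-suc : ∀ p ps n c → withCopies p ps (p + n) (suc c) ≡ map (p ∷_) (withCopies p ps n c)
withCopies-suc p ps n c
  rewrite [m+n]∸[m+o]≡n∸o p n (c * p)
        | does-⇔ (mk⇔ (+-cancelˡ-≤ p _ _) (+-monoʳ-≤ p)) (p + c * p ≤? p + n) (c * p ≤? n)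
  with does (c * p ≤? n)
... | true = map-∘ (partsFrom ps (n ∸ c * p))
... | false = refl

partsFrom-small : ∀ p ps {n} → n < p → partsFrom (p ∷ ps) n ≡ partsFrom ps n
partsFrom-small p ps {n} n<p = begin
    withCopies p ps n 0 ++ concatMap (withCopies p ps n) (applyUpTo suc n)
  ≡⟨ cong₂ _++_ (withCopies-zero p ps n)
       (concatMap-applyUpTo-truncate 0 n suc (λ i → withCopies-tooMany p ps (suc i) (<-≤-trans n<p (m≤m+n p _)))) ⟩
    partsFrom ps n ++ []
  ≡⟨ ++-identityʳ _ ⟩
    partsFrom ps n ∎
  where open ≡-Reasoning

partsFrom-step : ∀ p ps n → .{{NonZero p}} →
  partsFrom (p ∷ ps) (p + n) ≡ partsFrom ps (p + n) ++ map (p ∷_) (partsFrom (p ∷ ps) n)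
partsFrom-step p ps n = begin
    withCopies p ps (p + n) 0 ++ concatMap (withCopies p ps (p + n)) (applyUpTo suc (p + n))
  ≡⟨ cong₂ _++_ (withCopies-zero p ps (p + n))
       (concatMap-applyUpTo-cong (p + n) suc id (withCopies-suc p ps n)) ⟩
    partsFrom ps (p + n) ++ concatMap (map (p ∷_) ∘ withCopies p ps n) (upTo (p + n))
  ≡⟨ cong (partsFrom ps (p + n) ++_) (concatMap-map (p ∷_) (withCopies p ps n) (upTo (p + n))) ⟩
    partsFrom ps (p + n) ++ map (p ∷_) (concatMap (withCopies p ps n) (upTo (p + n)))
  ≡⟨ cong (λ k → partsFrom ps (p + n) ++ map (p ∷_) (concatMap (withCopies p ps n) (upTo k))) p+n≡1+n+[p-1] ⟩
    partsFrom ps (p + n) ++ map (p ∷_) (concatMap (withCopies p ps n) (upTo (suc n + pred p)))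
  ≡⟨ cong (λ l → partsFrom ps (p + n) ++ map (p ∷_) l)
       (concatMap-applyUpTo-truncate (suc n) (pred p) id
         (λ i → withCopies-tooMany p ps (suc n + i) (n<[1+n+i]*p i))) ⟩
    partsFrom ps (p + n) ++ map (p ∷_) (partsFrom (p ∷ ps) n) ∎
  where
  open ≡-Reasoning
  p+n≡1+n+[p-1] : p + n ≡ suc n + pred p
  p+n≡1+n+[p-1] = trans (+-comm p n) (trans (cong (n +_) (sym (suc-pred p))) (+-suc n (pred p)))
  n<[1+n+i]*p : ∀ i → n < (suc n + i) * p
  n<[1+n+i]*p i = ≤-trans (s≤s (m≤m+n n i)) (m≤m*n (suc n + i) p)

partsFrom-ind : ∀ (Q : ℕ → List (List ℕ) → Set) p ps .{{_ : NonZero p}} →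
  (∀ {n} → n < p → Q n (partsFrom ps n)) →
  (∀ k → Q k (partsFrom (p ∷ ps) k) → Q (p + k) (partsFrom ps (p + k) ++ map (p ∷_) (partsFrom (p ∷ ps) k))) →
  ∀ n → Q n (partsFrom (p ∷ ps) n)
partsFrom-ind Q p ps small step = <-rec _ go
  where
  go : ∀ n → (∀ {k} → k < n → Q k (partsFrom (p ∷ ps) k)) → Q n (partsFrom (p ∷ ps) n)
  go n rec with belowOrAbove p n
  ... | below n<p = subst (Q n) (sym (partsFrom-small p ps n<p)) (small n<p)
  ... | above k = subst (Q (p + k)) (sym (partsFrom-step p ps k)) (step k (rec (m<n+m k (>-nonZero⁻¹ p))))

partitionSum : List ℕ → (List ℕ → ℕ) → Series
partitionSum ps w n = sum (map w (partsFrom ps n))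

partitionSum-cong : ∀ ps {w w'} → (∀ l → w l ≡ w' l) → partitionSum ps w ≗ partitionSum ps w'
partitionSum-cong ps w≗w' n = cong sum (map-cong w≗w' (partsFrom ps n))

partitionSum-⊕ : ∀ ps w w' → partitionSum ps (λ l → w l + w' l) ≗ partitionSum ps w ⊕ partitionSum ps w'
partitionSum-⊕ ps w w' n = sum-map-+ (partsFrom ps n)
  where
  sum-map-+ : ∀ ls → sum (map (λ l → w l + w' l) ls) ≡ sum (map w ls) + sum (map w' ls)
  sum-map-+ [] = refl
  sum-map-+ (l ∷ ls) = trans (cong (w l + w' l +_) (sum-map-+ ls)) (+-interchange (w l) (w' l) _ _)

partitionSum-step : ∀ p ps w .{{_ : NonZero p}} →
  partitionSum (p ∷ ps) w ≗ partitionSum ps w ⊕ q^ p · partitionSum (p ∷ ps) (w ∘ (p ∷_))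
partitionSum-step p ps w n with belowOrAbove p n
... | below n<p = trans (cong (sum ∘ map w) (partsFrom-small p ps n<p))
  (sym (trans (cong (partitionSum ps w n +_) (q^·-< p _ n<p)) (+-identityʳ _)))
... | above k = begin
    sum (map w (partsFrom (p ∷ ps) (p + k)))
  ≡⟨ cong (sum ∘ map w) (partsFrom-step p ps k) ⟩
    sum (map w (partsFrom ps (p + k) ++ map (p ∷_) (partsFrom (p ∷ ps) k)))
  ≡⟨ cong sum (map-++ w (partsFrom ps (p + k)) _) ⟩
    sum (map w (partsFrom ps (p + k)) ++ map w (map (p ∷_) (partsFrom (p ∷ ps) k)))
  ≡⟨ sum-++ (map w (partsFrom ps (p + k))) _ ⟩
    partitionSum ps w (p + k) + sum (map w (map (p ∷_) (partsFrom (p ∷ ps) k)))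
  ≡⟨ cong (partitionSum ps w (p + k) +_) (cong sum (map-∘ (partsFrom (p ∷ ps) k))) ⟨
    partitionSum ps w (p + k) + partitionSum (p ∷ ps) (w ∘ (p ∷_)) k
  ≡⟨ cong (partitionSum ps w (p + k) +_) (q^·-+ p _ k) ⟨
    partitionSum ps w (p + k) + (q^ p · partitionSum (p ∷ ps) (w ∘ (p ∷_))) (p + k) ∎
  where open ≡-Reasoning

partitionSum-geomInv : ∀ p ps w .{{_ : NonZero p}} → (∀ l → w (p ∷ l) ≡ w l) →
  partitionSum (p ∷ ps) w ≗ geomInv p ⋆ partitionSum ps w
partitionSum-geomInv (suc p) ps w w-invariant = solve-geomInv p (partitionSum ps w) λ n →
  trans (partitionSum-step (suc p) ps w n)
    (cong (partitionSum ps w n +_) (q^·-cong (suc p) (partitionSum-cong (suc p ∷ ps) w-invariant) n))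

Descending : List ℕ → Set
Descending = AllPairs _≥_

IsPartitionInto : List ℕ → ℕ → List ℕ → Set
IsPartitionInto ps n l = Descending l × All (_∈ ps) l × sum l ≡ n

IsPartitionInto-∷ : ∀ {p ps n l} → IsPartitionInto ps n l → IsPartitionInto (p ∷ ps) n l
IsPartitionInto-∷ (desc , parts , total) = desc , All.map there parts , total

partsFrom-sound : ∀ ps → AllPairs _>_ ps → All NonZero ps → ∀ n → All (IsPartitionInto ps n) (partsFrom ps n)
partsFrom-sound [] [] [] zero = ([] , [] , refl) ∷ []
partsFrom-sound [] [] [] (suc n) = []
partsFrom-sound (p ∷ ps) (p>ps ∷ ps-decr) (p≢0 ∷ ps≢0) =
  partsFrom-ind (λ n → All (IsPartitionInto (p ∷ ps) n)) p ps {{p≢0}}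
    (λ {n} _ → All.map IsPartitionInto-∷ (sound n))
    (λ k hyp → ++⁺ (All.map IsPartitionInto-∷ (sound (p + k))) (map⁺ (All.map add-p hyp)))
  where
  sound : ∀ n → All (IsPartitionInto ps n) (partsFrom ps n)
  sound = partsFrom-sound ps ps-decr ps≢0
  ≤p : ∀ {x} → x ∈ p ∷ ps → x ≤ p
  ≤p (here refl) = ≤-refl
  ≤p (there x∈ps) = <⇒≤ (All.lookup p>ps x∈ps)
  add-p : ∀ {k l} → IsPartitionInto (p ∷ ps) k l → IsPartitionInto (p ∷ ps) (p + k) (p ∷ l)
  add-p (desc , parts , total) = All.map ≤p parts ∷ desc , here refl ∷ parts , cong (p +_) total

partsFrom-unique : ∀ ps → AllPairs _>_ ps → All NonZero ps → ∀ n → Unique (partsFrom ps n)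
partsFrom-unique [] [] [] zero = [] ∷ []
partsFrom-unique [] [] [] (suc n) = []
partsFrom-unique (p ∷ ps) (p>ps ∷ ps-decr) (p≢0 ∷ ps≢0) =
  partsFrom-ind (λ _ → Unique) p ps {{p≢0}} (λ {n} _ → unique n)
    (λ k hyp → Unique.++⁺ (unique (p + k)) (Unique.map⁺ ∷-injectiveʳ hyp) (disjoint k))
  where
  unique : ∀ n → Unique (partsFrom ps n)
  unique = partsFrom-unique ps ps-decr ps≢0
  disjoint : ∀ k → Disjoint (partsFrom ps (p + k)) (map (p ∷_) (partsFrom (p ∷ ps) k))
  disjoint k (l∈ , l∈p∷) with ∈-map⁻ (p ∷_) l∈p∷
  ... | l , _ , refl with All.lookup (partsFrom-sound ps ps-decr ps≢0 (p + k)) l∈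
  ... | _ , p∈ps ∷ _ , _ = <-irrefl refl (All.lookup p>ps p∈ps)

powersDown-suc : ∀ n → powersDown (suc n) ≡ 2 ^ suc n ∷ powersDown n
powersDown-suc n = begin
    reverse (applyUpTo (2 ^_) (suc (suc n)))
  ≡⟨ cong reverse (applyUpTo-∷ʳ (2 ^_) (suc n)) ⟨
    reverse (applyUpTo (2 ^_) (suc n) ∷ʳ 2 ^ suc n)
  ≡⟨ reverse-++ (applyUpTo (2 ^_) (suc n)) (2 ^ suc n ∷ []) ⟩
    2 ^ suc n ∷ powersDown n ∎
  where open ≡-Reasoning

IsPow2 : ℕ → Set
IsPow2 x = ∃[ k ] x ≡ 2 ^ k

powersDown-≤ : ∀ N → All (_≤ 2 ^ N) (powersDown N)
powersDown-≤ zero = ≤-refl ∷ []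
powersDown-≤ (suc N) rewrite powersDown-suc N =
  ≤-refl ∷ All.map (λ x≤2^N → ≤-trans x≤2^N (^-monoʳ-≤ 2 (n≤1+n N))) (powersDown-≤ N)

powersDown-decreasing : ∀ N → AllPairs _>_ (powersDown N)
powersDown-decreasing zero = [] ∷ []
powersDown-decreasing (suc N) rewrite powersDown-suc N =
  All.map (λ x≤2^N → <-≤-trans (s≤s x≤2^N) (^-monoʳ-< 2 (s≤s (s≤s z≤n)) (n<1+n N))) (powersDown-≤ N)
  ∷ powersDown-decreasing N

powersDown-pow2 : ∀ N → All IsPow2 (powersDown N)
powersDown-pow2 zero = (0 , refl) ∷ []
powersDown-pow2 (suc N) rewrite powersDown-suc N = (suc N , refl) ∷ powersDown-pow2 N

powersDown-nonZero : ∀ N → All NonZero (powersDown N)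
powersDown-nonZero N = All.map (λ { (k , refl) → m^n≢0 2 k }) (powersDown-pow2 N)

B-sound : ∀ n → All (λ l → Descending l × All IsPow2 l × sum l ≡ n) (B n)
B-sound n = All.map (λ { (desc , parts , total) → desc , All.map (All.lookup (powersDown-pow2 n)) parts , total })
  (partsFrom-sound (powersDown n) (powersDown-decreasing n) (powersDown-nonZero n) n)

B-unique : ∀ n → Unique (B n)
B-unique n = partsFrom-unique (powersDown n) (powersDown-decreasing n) (powersDown-nonZero n) n

m-++ : ∀ i xs ys → m i (xs ++ ys) ≡ m i xs + m i ys
m-++ i xs ys = trans (cong length (filter-++ (_≟ i) xs ys)) (length-++ (filter (_≟ i) xs))

m-∷-≢ : ∀ i x l → x ≢ i → m i (x ∷ l) ≡ m i l
m-∷-≢ i x l x≢i = cong length (filter-reject (_≟ i) x≢i)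

m-∷-≡ : ∀ i l → m i (i ∷ l) ≡ suc (m i l)
m-∷-≡ i l = cong length (filter-accept (_≟ i) {i} refl)

m-replicate : ∀ i n → m i (replicate n i) ≡ n
m-replicate i zero = refl
m-replicate i (suc n) = trans (m-∷-≡ i (replicate n i)) (cong suc (m-replicate i n))

m-replicate-≢ : ∀ i {x} n → x ≢ i → m i (replicate n x) ≡ 0
m-replicate-≢ i zero x≢i = refl
m-replicate-≢ i {x} (suc n) x≢i = trans (m-∷-≢ i x _ x≢i) (m-replicate-≢ i n x≢i)

onesTwosWeight : (ℕ → ℕ → ℕ) → List ℕ → ℕ
onesTwosWeight Φ l = Φ (m 1 l) (m 2 l)

2^[2+M]≢ : ∀ M {i} → i < 3 → 2 ^ (2 + M) ≢ i
2^[2+M]≢ M i<3 eq = <⇒≱ i<3 (subst (3 ≤_) eq (≤-trans (n≤1+n 3) (^-monoʳ-≤ 2 {2} {2 + M} (s≤s (s≤s z≤n)))))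

onesTwosWeight-∷-2^[2+M] : ∀ Φ M l → onesTwosWeight Φ (2 ^ (2 + M) ∷ l) ≡ onesTwosWeight Φ l
onesTwosWeight-∷-2^[2+M] Φ M l =
  cong₂ Φ (m-∷-≢ 1 _ l (2^[2+M]≢ M (s≤s (s≤s z≤n)))) (m-∷-≢ 2 _ l (2^[2+M]≢ M ≤-refl))

Π4 : ℕ → Series
Π4 zero = one
Π4 (suc M) = Π4 M ⋆ geomInv (2 ^ (2 + M))

W₁₂ : (ℕ → ℕ → ℕ) → Series
W₁₂ Φ = partitionSum (2 ∷ 1 ∷ []) (onesTwosWeight Φ)

-- The parts 1 and 2 are the only ones that Φ sees, the others are independent geometric factors.
partitionSum-powersDown : ∀ M Φ → partitionSum (powersDown (suc M)) (onesTwosWeight Φ) ≗ Π4 M ⋆ W₁₂ Φ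
partitionSum-powersDown zero Φ n = sym (⋆-identityˡ _ n)
partitionSum-powersDown (suc M) Φ = begin
    partitionSum (powersDown (suc (suc M))) (onesTwosWeight Φ)
  ≡⟨ cong (λ ps → partitionSum ps (onesTwosWeight Φ)) (powersDown-suc (suc M)) ⟩
    partitionSum (p ∷ powersDown (suc M)) (onesTwosWeight Φ)
  ≈⟨ partitionSum-geomInv p (powersDown (suc M)) (onesTwosWeight Φ) {{m^n≢0 2 (2 + M)}}
       (onesTwosWeight-∷-2^[2+M] Φ M) ⟩
    geomInv p ⋆ partitionSum (powersDown (suc M)) (onesTwosWeight Φ)
  ≈⟨ ⋆-congʳ _ (partitionSum-powersDown M Φ) ⟩
    geomInv p ⋆ (Π4 M ⋆ W₁₂ Φ)
  ≈⟨ solve 3 (λ g x y → g ⊗ (x ⊗ y) ⊜ (x ⊗ g) ⊗ y) ≗-refl (geomInv p) (Π4 M) (W₁₂ Φ) ⟩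
    Π4 (suc M) ⋆ W₁₂ Φ ∎
  where
  open ≗-Reasoning
  p : ℕ
  p = 2 ^ (2 + M)

n<2^n : ∀ n → n < 2 ^ n
n<2^n zero = s≤s z≤n
n<2^n (suc n) = +-mono-≤ {1} {2 ^ n} (m^n>0 2 n) (≤-trans (n<2^n n) (≤-reflexive (sym (+-identityʳ _))))

Π4-suc-agree : ∀ M {k} → k < 2 ^ (2 + M) → Π4 (suc M) k ≡ Π4 M k
Π4-suc-agree M {k} k<2^[2+M] = trans (⋆-comm (Π4 M) _ k)
  (geomInv-⋆-below (2 ^ (2 + M)) (Π4 M) {{m^n≢0 2 (2 + M)}} k<2^[2+M])

Π4-agree : ∀ M d {k} → k < 2 ^ (2 + M) → Π4 (d + M) k ≡ Π4 M k
Π4-agree M zero k<2^[2+M] = refl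
Π4-agree M (suc d) k<2^[2+M] = trans
  (Π4-suc-agree (d + M) (≤-trans k<2^[2+M] (^-monoʳ-≤ 2 (+-monoʳ-≤ 2 (m≤n+m M d)))))
  (Π4-agree M d k<2^[2+M])

-- The infinite product: by Π4-agree the coefficient of q^k in Π4 M is stable once 2^(2 + M) > k.
Π4∞ : Series
Π4∞ k = Π4 k k

Π4-Π4∞ : ∀ M {k} → k < 2 ^ (2 + M) → Π4 M k ≡ Π4∞ k
Π4-Π4∞ M {k} k<2^[2+M] with ≤-total M k
... | inj₁ M≤k = sym (trans (cong (λ r → Π4 r k) (sym (m∸n+n≡m M≤k))) (Π4-agree M (k ∸ M) k<2^[2+M]))
... | inj₂ k≤M = trans (cong (λ r → Π4 r k) (sym (m∸n+n≡m k≤M)))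
  (Π4-agree k (M ∸ k) (≤-trans (n<2^n k) (^-monoʳ-≤ 2 (m≤n+m k 2))))

binarySum : (ℕ → ℕ → ℕ) → Series
binarySum Φ n = partitionSum (powersDown n) (onesTwosWeight Φ) n

binarySum-Π4∞ : ∀ Φ → binarySum Φ ≗ Π4∞ ⋆ W₁₂ Φ
binarySum-Π4∞ Φ zero = sym (+-identityʳ _)
binarySum-Π4∞ Φ (suc n) = trans (partitionSum-powersDown n Φ (suc n))
  (⋆-agreeˡ (W₁₂ Φ) (suc n) (λ k≤1+n → Π4-Π4∞ n (≤-trans (s≤s k≤1+n) (<⇒≤ (n<2^n (suc (suc n)))))))

Π4-⟨q²⟩ : ∀ M → Π4 (suc M) ≗ geomInv 4 ⋆ Π4 M ⟨q²⟩
Π4-⟨q²⟩ zero =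
  ≗-trans (⋆-identityˡ (geomInv 4)) (≗-sym (≗-trans (⋆-congʳ (geomInv 4) ⟨q²⟩-one) (⋆-identityʳ (geomInv 4))))
Π4-⟨q²⟩ (suc M) = begin
    Π4 (suc M) ⋆ geomInv (2 ^ (3 + M))
  ≈⟨ ⋆-congˡ _ (Π4-⟨q²⟩ M) ⟩
    geomInv 4 ⋆ Π4 M ⟨q²⟩ ⋆ geomInv (2 ^ (3 + M))
  ≈⟨ ⋆-assoc (geomInv 4) _ _ ⟩
    geomInv 4 ⋆ (Π4 M ⟨q²⟩ ⋆ geomInv (2 ^ (3 + M)))
  ≡⟨ cong (λ r → geomInv 4 ⋆ (Π4 M ⟨q²⟩ ⋆ geomInv r)) (cong (2 ^ (2 + M) +_) (+-identityʳ _)) ⟩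
    geomInv 4 ⋆ (Π4 M ⟨q²⟩ ⋆ geomInv (2 ^ (2 + M) + 2 ^ (2 + M)))
  ≈⟨ ⋆-congʳ (geomInv 4) (⋆-congʳ (Π4 M ⟨q²⟩) (⟨q²⟩-geomInv (2 ^ (2 + M)) {{m^n≢0 2 (2 + M)}})) ⟨
    geomInv 4 ⋆ (Π4 M ⟨q²⟩ ⋆ geomInv (2 ^ (2 + M)) ⟨q²⟩)
  ≈⟨ ⋆-congʳ (geomInv 4) (⟨q²⟩-⋆ (Π4 M) _) ⟨
    geomInv 4 ⋆ Π4 (suc M) ⟨q²⟩ ∎
  where open ≗-Reasoning

Π4∞-⟨q²⟩ : Π4∞ ≗ geomInv 4 ⋆ Π4∞ ⟨q²⟩
Π4∞-⟨q²⟩ n = begin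
    Π4 n n
  ≡⟨ Π4-Π4∞ (suc n) (<-trans (n<2^n n) (^-monoʳ-< 2 (s≤s (s≤s z≤n)) (m≤n+m (suc n) 2))) ⟨
    Π4 (suc n) n
  ≡⟨ Π4-⟨q²⟩ n n ⟩
    (geomInv 4 ⋆ Π4 n ⟨q²⟩) n
  ≡⟨ ⋆-agreeʳ (geomInv 4) n (λ {k} k≤n →
       ⟨q²⟩-agree k (λ j≤k/2 → Π4-Π4∞ n (below-2^[2+n] (≤-trans j≤k/2 (≤-trans (m/n≤m k 2) k≤n))))) ⟩
    (geomInv 4 ⋆ Π4∞ ⟨q²⟩) n ∎
  where
  open ≡-Reasoning
  below-2^[2+n] : ∀ {j} → j ≤ n → j < 2 ^ (2 + n)
  below-2^[2+n] j≤n = ≤-<-trans j≤n (<-≤-trans (n<2^n n) (^-monoʳ-≤ 2 (m≤n+m n 2)))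

-- The parts 1 and 2 of pre₂ λ

insertDesc-↭ : ∀ x ys → insertDesc x ys ↭ x ∷ ys
insertDesc-↭ x [] = ↭-refl
insertDesc-↭ x (y ∷ ys) with does (y ≤? x)
... | true = ↭-refl
... | false = ↭-trans (↭-prep y (insertDesc-↭ x ys)) (↭-swap y x ↭-refl)

pre₂-↭ : ∀ xs → pre₂ xs ↭ pairProducts xs
pre₂-↭ xs = sortDesc-↭ (pairProducts xs)
  where
  sortDesc-↭ : ∀ xs → sortDesc xs ↭ xs
  sortDesc-↭ [] = ↭-refl
  sortDesc-↭ (x ∷ xs) = ↭-trans (insertDesc-↭ x (sortDesc xs)) (↭-prep x (sortDesc-↭ xs))

m-↭ : ∀ i {xs ys} → xs ↭ ys → m i xs ≡ m i ys
m-↭ i xs↭ys = ↭-length (filter-↭ (_≟ i) xs↭ys)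

m-map-≢ : ∀ i (f : ℕ → ℕ) ys → (∀ y → f y ≢ i) → m i (map f ys) ≡ 0
m-map-≢ i f [] f≢i = refl
m-map-≢ i f (y ∷ ys) f≢i = trans (m-∷-≢ i (f y) (map f ys) (f≢i y)) (m-map-≢ i f ys f≢i)

m-map-⇔ : ∀ i j (f : ℕ → ℕ) ys → (∀ y → f y ≡ i ⇔ y ≡ j) → m i (map f ys) ≡ m j ys
m-map-⇔ i j f [] f⇔ = refl
m-map-⇔ i j f (y ∷ ys) f⇔ with y ≟ j
... | yes refl =
  trans (m-∷-≡′ (Equivalence.from (f⇔ y) refl)) (trans (cong suc (m-map-⇔ i j f ys f⇔)) (sym (m-∷-≡ y ys)))
  where
  m-∷-≡′ : f y ≡ i → m i (f y ∷ map f ys) ≡ suc (m i (map f ys))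
  m-∷-≡′ refl = m-∷-≡ i _
... | no y≢j =
  trans (m-∷-≢ i (f y) _ (y≢j ∘ Equivalence.to (f⇔ y))) (trans (m-map-⇔ i j f ys f⇔) (sym (m-∷-≢ j y ys y≢j)))

m-map-1* : ∀ i ys → m i (map (1 *_) ys) ≡ m i ys
m-map-1* i ys = m-map-⇔ i i (1 *_) ys (λ y → mk⇔ (trans (sym (*-identityˡ y))) (trans (*-identityˡ y)))

m2-map-2* : ∀ ys → m 2 (map (2 *_) ys) ≡ m 1 ys
m2-map-2* ys = m-map-⇔ 2 1 (2 *_) ys (λ y → mk⇔ (*-cancelˡ-≡ y 1 2) λ { refl → refl })

choose2 : ℕ → ℕ
choose2 zero = 0
choose2 (suc n) = n + choose2 n

m1-pairProducts : ∀ xs → m 1 (pairProducts xs) ≡ choose2 (m 1 xs)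
m1-pairProducts [] = refl
m1-pairProducts (x ∷ xs) = trans (m-++ 1 (map (x *_) xs) (pairProducts xs)) (step x)
  where
  step : ∀ x → m 1 (map (x *_) xs) + m 1 (pairProducts xs) ≡ choose2 (m 1 (x ∷ xs))
  step 0 = trans (cong₂ _+_ (m-map-≢ 1 (0 *_) xs (λ _ ())) (m1-pairProducts xs))
    (sym (cong choose2 (m-∷-≢ 1 0 xs (λ ()))))
  step 1 = trans (cong₂ _+_ (m-map-1* 1 xs) (m1-pairProducts xs)) (sym (cong choose2 (m-∷-≡ 1 xs)))
  step (suc (suc x)) =
    trans (cong₂ _+_ (m-map-≢ 1 ((2 + x) *_) xs (λ y → 2+x≢1 ∘ m*n≡1⇒m≡1 (2 + x) y)) (m1-pairProducts xs))
    (sym (cong choose2 (m-∷-≢ 1 (2 + x) xs (λ ()))))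
    where
    2+x≢1 : 2 + x ≢ 1
    2+x≢1 ()

m2-pairProducts : ∀ xs → m 2 (pairProducts xs) ≡ m 1 xs * m 2 xs
m2-pairProducts [] = refl
m2-pairProducts (x ∷ xs) = trans (m-++ 2 (map (x *_) xs) (pairProducts xs))
  (trans (cong (m 2 (map (x *_) xs) +_) (m2-pairProducts xs)) (step x))
  where
  unchanged : ∀ x → x ≢ 1 → x ≢ 2 → m 1 (x ∷ xs) * m 2 (x ∷ xs) ≡ m 1 xs * m 2 xs
  unchanged x x≢1 x≢2 = cong₂ _*_ (m-∷-≢ 1 x xs x≢1) (m-∷-≢ 2 x xs x≢2)
  step : ∀ x → m 2 (map (x *_) xs) + m 1 xs * m 2 xs ≡ m 1 (x ∷ xs) * m 2 (x ∷ xs)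
  step 0 = trans (cong (_+ m 1 xs * m 2 xs) (m-map-≢ 2 (0 *_) xs (λ _ ()))) (sym (unchanged 0 (λ ()) (λ ())))
  step 1 = trans (cong (_+ m 1 xs * m 2 xs) (m-map-1* 2 xs)) (sym (cong₂ _*_ (m-∷-≡ 1 xs) (m-∷-≢ 2 1 xs (λ ()))))
  step 2 = trans (cong (_+ m 1 xs * m 2 xs) (m2-map-2* xs)) (trans (sym (*-suc (m 1 xs) (m 2 xs)))
    (sym (cong₂ _*_ (m-∷-≢ 1 2 xs (λ ())) (m-∷-≡ 2 xs))))
  step (suc (suc (suc x))) =
    trans (cong (_+ m 1 xs * m 2 xs) (m-map-≢ 2 ((3 + x) *_) xs 3+x*y≢2)) (sym (unchanged (3 + x) (λ ()) (λ ())))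
    where
    3+x*y≢2 : ∀ y → (3 + x) * y ≢ 2
    3+x*y≢2 zero eq = case-0≢2 (trans (sym (*-zeroʳ (3 + x))) eq)
      where case-0≢2 : 0 ≢ 2
            case-0≢2 ()
    3+x*y≢2 (suc y) eq = <⇒≱ (s≤s (s≤s (s≤s z≤n))) (subst (3 ≤_) eq (≤-trans (m≤m+n 3 x) (m≤m*n (3 + x) (suc y))))

-- Injectivity of pre₂ on binary partitions

powerSum : ℕ → List ℕ → ℕ
powerSum K l = sum (map (_^ K) l)

powerSum-↭ : ∀ K {xs ys} → xs ↭ ys → powerSum K xs ≡ powerSum K ys
powerSum-↭ K xs↭ys = sum-↭ (↭-map⁺ (_^ K) xs↭ys)

powerSum-++ : ∀ K l l' → powerSum K (l ++ l') ≡ powerSum K l + powerSum K l'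
powerSum-++ K l l' = trans (cong sum (map-++ (_^ K) l l')) (sum-++ (map (_^ K) l) _)

[m*n]^k≡m^k*n^k : ∀ m n k → (m * n) ^ k ≡ m ^ k * n ^ k
[m*n]^k≡m^k*n^k m n zero = refl
[m*n]^k≡m^k*n^k m n (suc k) = trans (cong (m * n *_) ([m*n]^k≡m^k*n^k m n k)) (regroup m n (m ^ k) (n ^ k))
  where
  regroup : ∀ a b c d → a * b * (c * d) ≡ a * c * (b * d)
  regroup = solve-∀

powerSum-map-* : ∀ K x l → powerSum K (map (x *_) l) ≡ x ^ K * powerSum K l
powerSum-map-* K x [] = sym (*-zeroʳ (x ^ K))
powerSum-map-* K x (y ∷ l) =
  trans (cong₂ _+_ ([m*n]^k≡m^k*n^k x y K) (powerSum-map-* K x l)) (sym (*-distribˡ-+ (x ^ K) _ _))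

powerSum-square : ∀ K l → powerSum K l * powerSum K l ≡ 2 * powerSum K (pairProducts l) + powerSum (K + K) l
powerSum-square K [] = refl
powerSum-square K (x ∷ l) = begin
    (x ^ K + s) * (x ^ K + s)
  ≡⟨ expand (x ^ K) s ⟩
    x ^ K * x ^ K + 2 * (x ^ K * s) + s * s
  ≡⟨ cong (x ^ K * x ^ K + 2 * (x ^ K * s) +_) (powerSum-square K l) ⟩
    x ^ K * x ^ K + 2 * (x ^ K * s) + (2 * e + powerSum (K + K) l)
  ≡⟨ regroup (x ^ K * x ^ K) (x ^ K * s) e (powerSum (K + K) l) ⟩
    2 * (x ^ K * s + e) + (x ^ K * x ^ K + powerSum (K + K) l)
  ≡⟨ cong₂ (λ y z → 2 * y + (z + powerSum (K + K) l))
       (sym (trans (powerSum-++ K (map (x *_) l) (pairProducts l)) (cong (_+ e) (powerSum-map-* K x l))))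
       (sym (^-distribˡ-+-* x K K)) ⟩
    2 * powerSum K (pairProducts (x ∷ l)) + powerSum (K + K) (x ∷ l) ∎
  where
  open ≡-Reasoning
  s : ℕ
  s = powerSum K l
  e : ℕ
  e = powerSum K (pairProducts l)
  expand : ∀ a s → (a + s) * (a + s) ≡ a * a + 2 * (a * s) + s * s
  expand = solve-∀
  regroup : ∀ aa as e t → aa + 2 * as + (2 * e + t) ≡ 2 * (as + e) + (aa + t)
  regroup = solve-∀

powerSum-double : ∀ K l l' → powerSum K l ≡ powerSum K l' →
  powerSum K (pairProducts l) ≡ powerSum K (pairProducts l') → powerSum (K + K) l ≡ powerSum (K + K) l'
powerSum-double K l l' p≡ e≡ = +-cancelˡ-≡ (2 * powerSum K (pairProducts l)) _ _ (begin
    2 * powerSum K (pairProducts l) + powerSum (K + K) l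
  ≡⟨ powerSum-square K l ⟨
    powerSum K l * powerSum K l
  ≡⟨ cong₂ _*_ p≡ p≡ ⟩
    powerSum K l' * powerSum K l'
  ≡⟨ powerSum-square K l' ⟩
    2 * powerSum K (pairProducts l') + powerSum (K + K) l'
  ≡⟨ cong (λ y → 2 * y + powerSum (K + K) l') e≡ ⟨
    2 * powerSum K (pairProducts l) + powerSum (K + K) l' ∎)
  where open ≡-Reasoning

powerSum-≤ : ∀ K {y} l → All (_≤ y) l → powerSum K l ≤ length l * y ^ K
powerSum-≤ K [] [] = z≤n
powerSum-≤ K (x ∷ l) (x≤y ∷ l≤y) = +-mono-≤ (^-monoˡ-≤ K x≤y) (powerSum-≤ K l l≤y)

IsPow2-2*-≤ : ∀ {x y} → IsPow2 x → IsPow2 y → y < x → 2 * y ≤ x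
IsPow2-2*-≤ (i , refl) (j , refl) 2^j<2^i with <-cmp j i
... | tri< j<i _ _ = ^-monoʳ-≤ 2 j<i
... | tri≈ _ refl _ = contradiction 2^j<2^i (<-irrefl refl)
... | tri> _ _ i<j = contradiction 2^j<2^i (≤⇒≯ (^-monoʳ-≤ 2 (<⇒≤ i<j)))

powerSum-head-dominates : ∀ K {x y} l → IsPow2 x → IsPow2 y → y < x → All (_≤ y) l →
  suc (length l) < 2 ^ K → y ^ K + powerSum K l < x ^ K
powerSum-head-dominates K {x} {y} l x-pow2 y-pow2@(j , refl) y<x l≤y 1+len<2^K = begin-strict
    y ^ K + powerSum K l
  ≤⟨ +-monoʳ-≤ (y ^ K) (powerSum-≤ K l l≤y) ⟩
    suc (length l) * y ^ K
  <⟨ *-monoˡ-< (y ^ K) {{m^n≢0 y K {{m^n≢0 2 j}}}} 1+len<2^K ⟩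
    2 ^ K * y ^ K
  ≡⟨ [m*n]^k≡m^k*n^k 2 y K ⟨
    (2 * y) ^ K
  ≤⟨ ^-monoˡ-≤ K (IsPow2-2*-≤ x-pow2 y-pow2 y<x) ⟩
    x ^ K ∎
  where open ≤-Reasoning

powerSum-injective : ∀ K {l l'} → Descending l → Descending l' → All IsPow2 l → All IsPow2 l' →
  length l < 2 ^ K → length l' < 2 ^ K → powerSum K l ≡ powerSum K l' → l ≡ l'
powerSum-injective K [] [] _ _ _ _ _ = refl
powerSum-injective K {[]} {y ∷ l'} _ _ _ ((j , refl) ∷ _) _ _ eq =
  contradiction eq (<⇒≢ (≤-trans (m^n>0 (2 ^ j) {{m^n≢0 2 j}} K) (m≤m+n _ _)))
powerSum-injective K {x ∷ l} {[]} _ _ ((i , refl) ∷ _) _ _ _ eq =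
  contradiction (sym eq) (<⇒≢ (≤-trans (m^n>0 (2 ^ i) {{m^n≢0 2 i}} K) (m≤m+n _ _)))
powerSum-injective K {x ∷ l} {y ∷ l'} (l≤x ∷ l-desc) (l'≤y ∷ l'-desc) (x-pow2 ∷ l-pow2) (y-pow2 ∷ l'-pow2)
                   len< len'< eq
  with <-cmp x y
... | tri< x<y _ _ =
  contradiction eq (<⇒≢ (<-≤-trans (powerSum-head-dominates K l y-pow2 x-pow2 x<y l≤x len<) (m≤m+n _ _)))
... | tri> _ _ y<x =
  contradiction (sym eq) (<⇒≢ (<-≤-trans (powerSum-head-dominates K l' x-pow2 y-pow2 y<x l'≤y len'<) (m≤m+n _ _)))
... | tri≈ _ refl _ = cong (x ∷_) (powerSum-injective K l-desc l'-desc l-pow2 l'-pow2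
  (<-trans (n<1+n _) len<) (<-trans (n<1+n _) len'<) (+-cancelˡ-≡ (x ^ K) _ _ eq))

-- pre₂ λ determines every power sum Σ λᵢ^(2^j) (induction on j through powerSum-double), and one
-- power sum with 2^K > length determines a descending list of powers of two.
pre₂-injective : ∀ {l l'} → Descending l → Descending l' → All IsPow2 l → All IsPow2 l' →
  sum l ≡ sum l' → pre₂ l ≡ pre₂ l' → l ≡ l'
pre₂-injective {l} {l'} l-desc l'-desc l-pow2 l'-pow2 sum≡ pre₂≡ =
  powerSum-injective (2 ^ n) l-desc l'-desc l-pow2 l'-pow2 (length< l l-pow2 refl) (length< l' l'-pow2 (sym sum≡))
    (powerSum-2^ n)
  where
  n : ℕ
  n = sum l
  length≤sum : ∀ l → All IsPow2 l → length l ≤ sum l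
  length≤sum [] [] = z≤n
  length≤sum (_ ∷ l) ((i , refl) ∷ l-pow2) = +-mono-≤ (m^n>0 2 i) (length≤sum l l-pow2)
  length< : ∀ l → All IsPow2 l → sum l ≡ n → length l < 2 ^ (2 ^ n)
  length< l l-pow2 sum≡n =
    <-trans (≤-<-trans (≤-trans (length≤sum l l-pow2) (≤-reflexive sum≡n)) (n<2^n n)) (n<2^n (2 ^ n))
  pairProducts≡ : ∀ K → powerSum K (pairProducts l) ≡ powerSum K (pairProducts l')
  pairProducts≡ K = trans (sym (powerSum-↭ K (pre₂-↭ l))) (trans (cong (powerSum K) pre₂≡) (powerSum-↭ K (pre₂-↭ l')))
  powerSum-2^ : ∀ j → powerSum (2 ^ j) l ≡ powerSum (2 ^ j) l'
  powerSum-2^ zero = trans (powerSum-1 l) (trans sum≡ (sym (powerSum-1 l')))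
    where
    powerSum-1 : ∀ l → powerSum 1 l ≡ sum l
    powerSum-1 l = cong sum (trans (map-cong *-identityʳ l) (map-id l))
  powerSum-2^ (suc j) = subst (λ K → powerSum K l ≡ powerSum K l') (cong (2 ^ j +_) (sym (+-identityʳ (2 ^ j))))
    (powerSum-double (2 ^ j) l l' (powerSum-2^ j) (pairProducts≡ (2 ^ j)))

map⁺-injectiveOn : ∀ {A B : Set} {G : A → Set} (f : A → B) → (∀ {x y} → G x → G y → f x ≡ f y → x ≡ y) →
  ∀ {xs} → All G xs → Unique xs → Unique (map f xs)
map⁺-injectiveOn f f-inj [] [] = []
map⁺-injectiveOn {G = G} f f-inj {x ∷ xs} (gx ∷ gxs) (x∉xs ∷ xs-unique) =
  fx∉ gxs x∉xs ∷ map⁺-injectiveOn f f-inj gxs xs-unique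
  where
  fx∉ : ∀ {ys} → All G ys → All (x ≢_) ys → All (f x ≢_) (map f ys)
  fx∉ [] [] = []
  fx∉ (gy ∷ gys) (x≢y ∷ x≢ys) = (x≢y ∘ f-inj gx gy) ∷ fx∉ gys x≢ys

deduplicate-unique : ∀ {A : Set} (_≟ₐ_ : DecidableEquality A) {xs} → Unique xs → deduplicate _≟ₐ_ xs ≡ xs
deduplicate-unique _≟ₐ_ [] = refl
deduplicate-unique _≟ₐ_ {x ∷ xs} (x∉xs ∷ xs-unique) =
  cong (x ∷_) (trans (cong (filter _) (deduplicate-unique _≟ₐ_ xs-unique)) (filter-all _ x∉xs))

sum-map-filter : ∀ {A : Set} {P : A → Set} (P? : Decidable P) (f : A → ℕ) xs → (∀ x → ¬ P x → f x ≡ 0) →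
  sum (map f (filter P? xs)) ≡ sum (map f xs)
sum-map-filter P? f [] f≡0 = refl
sum-map-filter P? f (x ∷ xs) f≡0 with P? x
... | yes _ = cong (f x +_) (sum-map-filter P? f xs f≡0)
... | no ¬px = trans (sum-map-filter P? f xs f≡0) (cong (_+ sum (map f xs)) (sym (f≡0 x ¬px)))

-- Distinct binary partitions have distinct images, so ImB₂ n merely drops the one-part partition.
mSet-ImB₂ : ∀ i n → mSet i (ImB₂ n) ≡ sum (map (m i ∘ pre₂) (B n))
mSet-ImB₂ i n = begin
    sum (map (m i) (deduplicate (≡-dec _≟_) (map pre₂ (B₂ n))))
  ≡⟨ cong (sum ∘ map (m i)) (deduplicate-unique (≡-dec _≟_) images-unique) ⟩
    sum (map (m i) (map pre₂ (B₂ n)))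
  ≡⟨ cong sum (map-∘ (B₂ n)) ⟨
    sum (map (m i ∘ pre₂) (B₂ n))
  ≡⟨ sum-map-filter 2≤length? (m i ∘ pre₂) (B n) one-part ⟩
    sum (map (m i ∘ pre₂) (B n)) ∎
  where
  open ≡-Reasoning
  2≤length? : ∀ (l : List ℕ) → Dec (2 ≤ length l)
  2≤length? l = 2 ≤? length l
  images-unique : Unique (map pre₂ (B₂ n))
  images-unique = map⁺-injectiveOn pre₂
    (λ { (desc , pow2 , total) (desc' , pow2' , total') →
           pre₂-injective desc desc' pow2 pow2' (trans total (sym total')) })
    (filter⁺ 2≤length? (B-sound n)) (Unique.filter⁺ 2≤length? (B-unique n))
  one-part : ∀ l → ¬ 2 ≤ length l → m i (pre₂ l) ≡ 0
  one-part [] _ = refl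
  one-part (_ ∷ []) _ = refl
  one-part (_ ∷ _ ∷ _) 1≥length = contradiction (s≤s (s≤s z≤n)) 1≥length

P : Series
P n = length (B n)

P≗binarySum : P ≗ binarySum (λ _ _ → 1)
P≗binarySum n = length-as-sum (B n)
  where
  length-as-sum : ∀ {A : Set} (xs : List A) → length xs ≡ sum (map (λ _ → 1) xs)
  length-as-sum [] = refl
  length-as-sum (_ ∷ xs) = cong suc (length-as-sum xs)

a≗binarySum : a ≗ binarySum (λ i _ → choose2 i)
a≗binarySum n = trans (mSet-ImB₂ 1 n)
  (cong sum (map-cong (λ l → trans (m-↭ 1 (pre₂-↭ l)) (m1-pairProducts l)) (B n)))

b≗binarySum : b ≗ binarySum _*_
b≗binarySum n = trans (mSet-ImB₂ 2 n)
  (cong sum (map-cong (λ l → trans (m-↭ 2 (pre₂-↭ l)) (m2-pairProducts l)) (B n)))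

-- Generating functions

W₁₂-step : ∀ Φ → W₁₂ Φ ≗ (λ n → Φ n 0) ⊕ q^ 2 · W₁₂ (λ i j → Φ i (suc j))
W₁₂-step Φ n = trans (partitionSum-step 2 (1 ∷ []) (onesTwosWeight Φ) n)
  (cong₂ _+_ only-ones (q^·-cong 2 (partitionSum-cong (2 ∷ 1 ∷ []) count-2) n))
  where
  partsFrom-1 : ∀ n → partsFrom (1 ∷ []) n ≡ replicate n 1 ∷ []
  partsFrom-1 zero = refl
  partsFrom-1 (suc n) = trans (partsFrom-step 1 [] n) (cong (map (1 ∷_)) (partsFrom-1 n))
  only-ones : partitionSum (1 ∷ []) (onesTwosWeight Φ) n ≡ Φ n 0
  only-ones = trans (cong (sum ∘ map (onesTwosWeight Φ)) (partsFrom-1 n))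
    (trans (+-identityʳ _) (cong₂ Φ (m-replicate 1 n) (m-replicate-≢ 2 n (λ ()))))
  count-2 : ∀ l → onesTwosWeight Φ (2 ∷ l) ≡ onesTwosWeight (λ i j → Φ i (suc j)) l
  count-2 l = cong₂ Φ (m-∷-≢ 1 2 l (λ ())) (m-∷-≡ 2 l)

W₁₂-m₁ : ∀ φ → W₁₂ (λ i _ → φ i) ≗ geomInv 2 ⋆ φ
W₁₂-m₁ φ = solve-geomInv 1 φ (W₁₂-step (λ i _ → φ i))

W₁₂-* : W₁₂ _*_ ≗ geomInv 2 ⋆ q^ 2 · W₁₂ (λ i _ → i)
W₁₂-* = solve-geomInv 1 _ λ n → begin
    W₁₂ _*_ n
  ≡⟨ W₁₂-step _*_ n ⟩
    n * 0 + (q^ 2 · W₁₂ (λ i j → i * suc j)) n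
  ≡⟨ cong₂ _+_ (*-zeroʳ n) (q^·-cong 2 (λ k → trans
       (partitionSum-cong (2 ∷ 1 ∷ []) (λ l → *-suc (m 1 l) (m 2 l)) k)
       (partitionSum-⊕ (2 ∷ 1 ∷ []) (onesTwosWeight (λ i _ → i)) (onesTwosWeight _*_) k)) n) ⟩
    (q^ 2 · (W₁₂ (λ i _ → i) ⊕ W₁₂ _*_)) n
  ≡⟨ q^·-⊕ 2 (W₁₂ (λ i _ → i)) (W₁₂ _*_) n ⟩
    (q^ 2 · W₁₂ (λ i _ → i)) n + (q^ 2 · W₁₂ _*_) n ∎
  where open ≡-Reasoning

ones⋆ones : ∀ n → (ones ⋆ ones) n ≡ suc n
ones⋆ones zero = refl
ones⋆ones (suc n) = trans (ones-⋆-suc ones n) (cong suc (ones⋆ones n))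

id≗q·ones⋆ones : id ≗ q^ 1 · (ones ⋆ ones)
id≗q·ones⋆ones zero = refl
id≗q·ones⋆ones (suc n) = sym (ones⋆ones n)

choose2≗q²·ones⋆[ones⋆ones] : choose2 ≗ q^ 2 · (ones ⋆ (ones ⋆ ones))
choose2≗q²·ones⋆[ones⋆ones] zero = refl
choose2≗q²·ones⋆[ones⋆ones] (suc zero) = refl
choose2≗q²·ones⋆[ones⋆ones] (suc (suc n)) = shifted n
  where
  shifted : ∀ n → choose2 (suc (suc n)) ≡ (ones ⋆ (ones ⋆ ones)) n
  shifted zero = refl
  shifted (suc n) = trans (cong₂ _+_ (sym (ones⋆ones (suc n))) (shifted n)) (sym (ones-⋆-suc (ones ⋆ ones) n))

ones≗geomInv1 : ones ≗ geomInv 1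
ones≗geomInv1 = ≗-trans (solve-geomInv 0 one {ones} λ { zero → refl ; (suc n) → refl }) (⋆-identityʳ (geomInv 1))

ones⟨q²⟩≗geomInv2 : ones ⟨q²⟩ ≗ geomInv 2
ones⟨q²⟩≗geomInv2 = ≗-trans (⟨q²⟩-cong ones≗geomInv1) (⟨q²⟩-geomInv 1)

P≗Π4∞⋆G2⋆ones : P ≗ Π4∞ ⋆ (geomInv 2 ⋆ ones)
P≗Π4∞⋆G2⋆ones n = trans (P≗binarySum n) (trans (binarySum-Π4∞ _ n) (⋆-congʳ Π4∞ (W₁₂-m₁ (λ _ → 1)) n))

b-generatingFunction : b ≗ q^ 3 · (ones ⋆ geomInv 2 ⋆ P)
b-generatingFunction = begin
    b
  ≈⟨ b≗binarySum ⟩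
    binarySum _*_
  ≈⟨ binarySum-Π4∞ _*_ ⟩
    Π4∞ ⋆ W₁₂ _*_
  ≈⟨ ⋆-congʳ Π4∞ (≗-trans W₁₂-* (⋆-congʳ G2 (q^·-cong 2 (≗-trans (W₁₂-m₁ id) (⋆-congʳ G2 id≗q·ones⋆ones))))) ⟩
    Π4∞ ⋆ (G2 ⋆ q^ 2 · (G2 ⋆ q^ 1 · (ones ⋆ ones)))
  ≈⟨ ⋆-congʳ Π4∞ (⋆-congʳ G2 (q^·-cong 2 (⋆-q^·ʳ 1 G2 (ones ⋆ ones)))) ⟩
    Π4∞ ⋆ (G2 ⋆ q^ 2 · q^ 1 · (G2 ⋆ (ones ⋆ ones)))
  ≈⟨ ⋆-congʳ Π4∞ (⋆-congʳ G2 (q^·-q^· 2 1 _)) ⟩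
    Π4∞ ⋆ (G2 ⋆ q^ 3 · (G2 ⋆ (ones ⋆ ones)))
  ≈⟨ ⋆-congʳ Π4∞ (⋆-q^·ʳ 3 G2 _) ⟩
    Π4∞ ⋆ q^ 3 · (G2 ⋆ (G2 ⋆ (ones ⋆ ones)))
  ≈⟨ ⋆-q^·ʳ 3 Π4∞ _ ⟩
    q^ 3 · (Π4∞ ⋆ (G2 ⋆ (G2 ⋆ (ones ⋆ ones))))
  ≈⟨ q^·-cong 3 (solve 3 (λ Π g o → Π ⊗ (g ⊗ (g ⊗ (o ⊗ o))) ⊜ (o ⊗ g) ⊗ (Π ⊗ (g ⊗ o))) ≗-refl Π4∞ G2 ones) ⟩
    q^ 3 · (ones ⋆ G2 ⋆ (Π4∞ ⋆ (G2 ⋆ ones)))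
  ≈⟨ q^·-cong 3 (⋆-congʳ (ones ⋆ G2) P≗Π4∞⋆G2⋆ones) ⟨
    q^ 3 · (ones ⋆ G2 ⋆ P) ∎
  where
  open ≗-Reasoning
  G2 : Series
  G2 = geomInv 2

a-generatingFunction : a ≗ q^ 2 · (ones ⋆ ones ⋆ P)
a-generatingFunction = begin
    a
  ≈⟨ a≗binarySum ⟩
    binarySum (λ i _ → choose2 i)
  ≈⟨ binarySum-Π4∞ (λ i _ → choose2 i) ⟩
    Π4∞ ⋆ W₁₂ (λ i _ → choose2 i)
  ≈⟨ ⋆-congʳ Π4∞ (λ n → trans (W₁₂-m₁ choose2 n) (⋆-congʳ G2 choose2≗q²·ones⋆[ones⋆ones] n)) ⟩
    Π4∞ ⋆ (G2 ⋆ q^ 2 · (ones ⋆ (ones ⋆ ones)))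
  ≈⟨ ⋆-congʳ Π4∞ (⋆-q^·ʳ 2 G2 _) ⟩
    Π4∞ ⋆ q^ 2 · (G2 ⋆ (ones ⋆ (ones ⋆ ones)))
  ≈⟨ ⋆-q^·ʳ 2 Π4∞ _ ⟩
    q^ 2 · (Π4∞ ⋆ (G2 ⋆ (ones ⋆ (ones ⋆ ones))))
  ≈⟨ q^·-cong 2 (solve 3 (λ Π g o → Π ⊗ (g ⊗ (o ⊗ (o ⊗ o))) ⊜ (o ⊗ o) ⊗ (Π ⊗ (g ⊗ o))) ≗-refl Π4∞ G2 ones) ⟩
    q^ 2 · (ones ⋆ ones ⋆ (Π4∞ ⋆ (G2 ⋆ ones)))
  ≈⟨ q^·-cong 2 (⋆-congʳ (ones ⋆ ones) P≗Π4∞⋆G2⋆ones) ⟨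
    q^ 2 · (ones ⋆ ones ⋆ P) ∎
  where
  open ≗-Reasoning
  G2 : Series
  G2 = geomInv 2

P-generatingFunction : P ≗ ones ⋆ P ⟨q²⟩
P-generatingFunction = begin
    P
  ≈⟨ P≗Π4∞⋆G2⋆ones ⟩
    Π4∞ ⋆ (G2 ⋆ ones)
  ≈⟨ ⋆-congˡ _ Π4∞-⟨q²⟩ ⟩
    geomInv 4 ⋆ Π4∞ ⟨q²⟩ ⋆ (G2 ⋆ ones)
  ≈⟨ solve 4 (λ g₄ Π g₂ o → (g₄ ⊗ Π) ⊗ (g₂ ⊗ o) ⊜ o ⊗ (Π ⊗ (g₄ ⊗ g₂))) ≗-refl (geomInv 4) (Π4∞ ⟨q²⟩) G2 ones ⟩
    ones ⋆ (Π4∞ ⟨q²⟩ ⋆ (geomInv 4 ⋆ G2))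
  ≈⟨ ⋆-congʳ ones (⋆-congʳ (Π4∞ ⟨q²⟩) (⋆-cong (⟨q²⟩-geomInv 2) ones⟨q²⟩≗geomInv2)) ⟨
    ones ⋆ (Π4∞ ⟨q²⟩ ⋆ (G2 ⟨q²⟩ ⋆ ones ⟨q²⟩))
  ≈⟨ ⋆-congʳ ones (≗-trans (⋆-congʳ (Π4∞ ⟨q²⟩) (≗-sym (⟨q²⟩-⋆ G2 ones))) (≗-sym (⟨q²⟩-⋆ Π4∞ _))) ⟩
    ones ⋆ (Π4∞ ⋆ (G2 ⋆ ones)) ⟨q²⟩
  ≈⟨ ⋆-congʳ ones (⟨q²⟩-cong P≗Π4∞⋆G2⋆ones) ⟨
    ones ⋆ P ⟨q²⟩ ∎
  where
  open ≗-Reasoning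
  G2 : Series
  G2 = geomInv 2

binProdUpTo-Π4 : ∀ M → binProdUpTo (2 + M) ≗ geomInv 1 ⋆ geomInv 2 ⋆ Π4 M
binProdUpTo-Π4 zero = begin
    binProdUpTo 1 ⊛ geomInv 2
  ≈⟨ ⊛≗⋆ _ (geomInv 2) ⟩
    binProdUpTo 1 ⋆ geomInv 2
  ≈⟨ ⋆-congˡ (geomInv 2) (≗-trans (⊛≗⋆ one (geomInv 1)) (⋆-identityˡ (geomInv 1))) ⟩
    geomInv 1 ⋆ geomInv 2
  ≈⟨ ⋆-identityʳ _ ⟨
    geomInv 1 ⋆ geomInv 2 ⋆ one ∎
  where open ≗-Reasoning
binProdUpTo-Π4 (suc M) = begin
    binProdUpTo (2 + M) ⊛ geomInv (2 ^ (2 + M))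
  ≈⟨ ⊛≗⋆ _ _ ⟩
    binProdUpTo (2 + M) ⋆ geomInv (2 ^ (2 + M))
  ≈⟨ ⋆-congˡ _ (binProdUpTo-Π4 M) ⟩
    geomInv 1 ⋆ geomInv 2 ⋆ Π4 M ⋆ geomInv (2 ^ (2 + M))
  ≈⟨ ⋆-assoc (geomInv 1 ⋆ geomInv 2) (Π4 M) _ ⟩
    geomInv 1 ⋆ geomInv 2 ⋆ Π4 (suc M) ∎
  where open ≗-Reasoning

binProd≗P : binProd ≗ P
binProd≗P zero = refl
binProd≗P (suc n) = begin
    binProdUpTo (2 + n) (suc n)
  ≡⟨ binProdUpTo-Π4 n (suc n) ⟩
    (geomInv 1 ⋆ geomInv 2 ⋆ Π4 n) (suc n)
  ≡⟨ ⋆-agreeʳ (geomInv 1 ⋆ geomInv 2) (suc n) (λ k≤1+n → Π4-Π4∞ n (≤-trans (s≤s k≤1+n) (<⇒≤ (n<2^n (2 + n))))) ⟩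
    (geomInv 1 ⋆ geomInv 2 ⋆ Π4∞) (suc n)
  ≡⟨ solve 3 (λ g₁ g₂ Π → (g₁ ⊗ g₂) ⊗ Π ⊜ Π ⊗ (g₂ ⊗ g₁)) ≗-refl (geomInv 1) (geomInv 2) Π4∞ (suc n) ⟩
    (Π4∞ ⋆ (geomInv 2 ⋆ geomInv 1)) (suc n)
  ≡⟨ ⋆-congʳ Π4∞ (⋆-congʳ (geomInv 2) ones≗geomInv1) (suc n) ⟨
    (Π4∞ ⋆ (geomInv 2 ⋆ ones)) (suc n)
  ≡⟨ P≗Π4∞⋆G2⋆ones (suc n) ⟨
    P (suc n) ∎
  where open ≡-Reasoning

b≗rhsA : b ≗ rhsA
b≗rhsA = begin
    b
  ≈⟨ b-generatingFunction ⟩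
    q^ 3 · (ones ⋆ geomInv 2 ⋆ P)
  ≈⟨ q^·-cong 3 (⋆-cong (⋆-congˡ (geomInv 2) ones≗geomInv1) (≗-sym binProd≗P)) ⟩
    q^ 3 · (geomInv 1 ⋆ geomInv 2 ⋆ binProd)
  ≈⟨ q^·-cong 3 (≗-trans (⊛≗⋆ (geomInv 1 ⊛ geomInv 2) binProd) (⋆-congˡ binProd (⊛≗⋆ (geomInv 1) (geomInv 2)))) ⟨
    q^ 3 · ((geomInv 1 ⊛ geomInv 2) ⊛ binProd)
  ≈⟨ shift≗q^· 3 _ ⟨
    rhsA ∎
  where open ≗-Reasoning

⌊n/2⌋≗q²·ones⋆G2 : (λ n → n / 2) ≗ q^ 2 · (ones ⋆ geomInv 2)
⌊n/2⌋≗q²·ones⋆G2 zero = refl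
⌊n/2⌋≗q²·ones⋆G2 (suc zero) = refl
⌊n/2⌋≗q²·ones⋆G2 (suc (suc n)) = trans ([2+n]/2≡1+n/2 n) (sym (ones⋆G2 n))
  where
  ones⋆G2 : ∀ n → (ones ⋆ geomInv 2) n ≡ suc (n / 2)
  ones⋆G2 n = trans (⋆-comm ones (geomInv 2) n) (G2⋆ones n)
    where
    G2⋆ones : ∀ n → (geomInv 2 ⋆ ones) n ≡ suc (n / 2)
    G2⋆ones zero = refl
    G2⋆ones (suc zero) = refl
    G2⋆ones (suc (suc n)) =
      trans (geomInv-⋆-fixpoint 1 ones (2 + n)) (cong suc (trans (G2⋆ones n) (sym ([2+n]/2≡1+n/2 n))))

b[n]≡Σ⌊[i-1]/2⌋|B[n-i]| : ∀ n → b n ≡ Σ[ 1 ⋯ n ] (λ i → ((i ∸ 1) / 2) * length (B (n ∸ i)))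
b[n]≡Σ⌊[i-1]/2⌋|B[n-i]| zero = b-generatingFunction 0
b[n]≡Σ⌊[i-1]/2⌋|B[n-i]| (suc n) = begin
    b (suc n)
  ≡⟨ b-generatingFunction (suc n) ⟩
    (q^ 2 · (ones ⋆ geomInv 2 ⋆ P)) n
  ≡⟨ ⋆-q^·ˡ 2 (ones ⋆ geomInv 2) P n ⟨
    (q^ 2 · (ones ⋆ geomInv 2) ⋆ P) n
  ≡⟨ ⋆-congˡ P ⌊n/2⌋≗q²·ones⋆G2 n ⟨
    ((λ k → k / 2) ⋆ P) n
  ≡⟨ ⋆≗Σ (λ k → k / 2) P n ⟩
    Σ[ 1 ⋯ suc n ] (λ i → ((i ∸ 1) / 2) * length (B (suc n ∸ i))) ∎
  where open ≡-Reasoning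

1+q : Series
1+q = one ⊕ q^ 1 · one

1+q⋆ : ∀ f → 1+q ⋆ f ≗ f ⊕ q^ 1 · f
1+q⋆ f n = trans (⋆-distribʳ-⊕ one (q^ 1 · one) f n)
  (cong₂ _+_ (⋆-identityˡ f n) (trans (⋆-q^·ˡ 1 one f n) (q^·-cong 1 (⋆-identityˡ f) n)))

1+q⋆⟨q²⟩ : ∀ f n → (1+q ⋆ f ⟨q²⟩) n ≡ f (n / 2)
1+q⋆⟨q²⟩ f n = trans (1+q⋆ (f ⟨q²⟩) n) (⟨q²⟩-⊕-q· f n)

ones≗1+q⋆G2 : ones ≗ 1+q ⋆ geomInv 2
ones≗1+q⋆G2 n = sym (trans (⋆-congʳ 1+q (≗-sym ones⟨q²⟩≗geomInv2) n) (1+q⋆⟨q²⟩ ones n))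

a[n]≡b[n]+b[n+1] : ∀ n → a n ≡ b n + b (suc n)
a[n]≡b[n]+b[n+1] n = begin
    a n
  ≡⟨ a-generatingFunction n ⟩
    (q^ 2 · (ones ⋆ ones ⋆ P)) n
  ≡⟨ q^·-cong 2 (λ k → trans (⋆-congˡ P (⋆-congʳ ones ones≗1+q⋆G2) k) (rearrange k)) n ⟩
    (q^ 2 · (Z ⊕ q^ 1 · Z)) n
  ≡⟨ q^·-⊕ 2 Z (q^ 1 · Z) n ⟩
    (q^ 2 · Z) n + (q^ 2 · q^ 1 · Z) n
  ≡⟨ +-comm ((q^ 2 · Z) n) _ ⟩
    (q^ 2 · q^ 1 · Z) n + (q^ 2 · Z) n
  ≡⟨ cong₂ _+_ (trans (q^·-q^· 2 1 Z n) (sym (b-generatingFunction n))) (sym (b-generatingFunction (suc n))) ⟩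
    b n + b (suc n) ∎
  where
  open ≡-Reasoning
  Z : Series
  Z = ones ⋆ geomInv 2 ⋆ P
  rearrange : ones ⋆ (1+q ⋆ geomInv 2) ⋆ P ≗ Z ⊕ q^ 1 · Z
  rearrange =
    ≗-trans (solve 4 (λ o u g p → (o ⊗ (u ⊗ g)) ⊗ p ⊜ u ⊗ ((o ⊗ g) ⊗ p)) ≗-refl ones 1+q (geomInv 2) P) (1+q⋆ Z)

tail-b : tail b ≗ ones ⋆ (λ k → a (suc (k / 2)))
tail-b = begin
    tail b
  ≈⟨ b-generatingFunction ∘ suc ⟩
    q^ 2 · (ones ⋆ G2 ⋆ P)
  ≈⟨ q^·-cong 2 (⋆-congʳ (ones ⋆ G2) P-generatingFunction) ⟩
    q^ 2 · (ones ⋆ G2 ⋆ (ones ⋆ P ⟨q²⟩))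
  ≈⟨ q^·-cong 2 (⋆-congʳ (ones ⋆ G2) (⋆-congˡ (P ⟨q²⟩) ones≗1+q⋆G2)) ⟩
    q^ 2 · (ones ⋆ G2 ⋆ (1+q ⋆ G2 ⋆ P ⟨q²⟩))
  ≈⟨ q^·-cong 2
       (solve 4 (λ o g u p → (o ⊗ g) ⊗ ((u ⊗ g) ⊗ p) ⊜ o ⊗ (u ⊗ ((g ⊗ g) ⊗ p))) ≗-refl ones G2 1+q (P ⟨q²⟩)) ⟩
    q^ 2 · (ones ⋆ (1+q ⋆ (G2 ⋆ G2 ⋆ P ⟨q²⟩)))
  ≈⟨ q^·-cong 2 (⋆-congʳ ones (⋆-congʳ 1+q [ones⋆ones⋆P]⟨q²⟩)) ⟨
    q^ 2 · (ones ⋆ (1+q ⋆ (ones ⋆ ones ⋆ P) ⟨q²⟩))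
  ≈⟨ ≗-trans (⋆-congʳ ones (⋆-q^·ʳ 2 1+q _)) (⋆-q^·ʳ 2 ones _) ⟨
    ones ⋆ (1+q ⋆ q^ 2 · (ones ⋆ ones ⋆ P) ⟨q²⟩)
  ≈⟨ ⋆-congʳ ones (⋆-congʳ 1+q (≗-sym (⟨q²⟩-q^· 1 (ones ⋆ ones ⋆ P)))) ⟩
    ones ⋆ (1+q ⋆ (q^ 1 · (ones ⋆ ones ⋆ P)) ⟨q²⟩)
  ≈⟨ ⋆-congʳ ones (⋆-congʳ 1+q (⟨q²⟩-cong (a-generatingFunction ∘ suc))) ⟨
    ones ⋆ (1+q ⋆ tail a ⟨q²⟩)
  ≈⟨ ⋆-congʳ ones (1+q⋆⟨q²⟩ (tail a)) ⟩
    ones ⋆ (λ k → a (suc (k / 2))) ∎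
  where
  open ≗-Reasoning
  G2 : Series
  G2 = geomInv 2
  [ones⋆ones⋆P]⟨q²⟩ : (ones ⋆ ones ⋆ P) ⟨q²⟩ ≗ G2 ⋆ G2 ⋆ P ⟨q²⟩
  [ones⋆ones⋆P]⟨q²⟩ = ≗-trans (⟨q²⟩-⋆ (ones ⋆ ones) P)
    (⋆-congˡ (P ⟨q²⟩) (≗-trans (⟨q²⟩-⋆ ones ones) (⋆-cong ones⟨q²⟩≗geomInv2 ones⟨q²⟩≗geomInv2)))

b[n+1]≡b[n]+a[1+n/2] : ∀ n → b (suc n) ≡ b n + a (suc (n / 2))
b[n+1]≡b[n]+a[1+n/2] zero = trans (tail-b 0) (trans (+-identityʳ _) (cong (_+ a 1) (sym (b-generatingFunction 0))))
b[n+1]≡b[n]+a[1+n/2] (suc n) = begin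
    b (2 + n)
  ≡⟨ tail-b (suc n) ⟩
    (ones ⋆ (λ k → a (suc (k / 2)))) (suc n)
  ≡⟨ ones-⋆-suc _ n ⟩
    a (suc (suc n / 2)) + (ones ⋆ (λ k → a (suc (k / 2)))) n
  ≡⟨ +-comm (a (suc (suc n / 2))) _ ⟩
    (ones ⋆ (λ k → a (suc (k / 2)))) n + a (suc (suc n / 2))
  ≡⟨ cong (_+ a (suc (suc n / 2))) (tail-b n) ⟨
    b (suc n) + a (suc (suc n / 2)) ∎
  where open ≡-Reasoning

b[n+1]-b[n]≡a[n/2+1] : ∀ n → ⁺ b (suc n) ℤ.- ⁺ b n ≡ ⁺ a (n / 2 + 1)
b[n+1]-b[n]≡a[n/2+1] n = begin
    ⁺ b (suc n) ℤ.- ⁺ b n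
  ≡⟨ cong (λ x → ⁺ x ℤ.- ⁺ b n) (b[n+1]≡b[n]+a[1+n/2] n) ⟩
    ⁺ (b n + a (suc (n / 2))) ℤ.- ⁺ b n
  ≡⟨ cong (ℤ._- ⁺ b n) (ℤ.pos-+ (b n) _) ⟩
    ⁺ b n ℤ.+ ⁺ a (suc (n / 2)) ℤ.- ⁺ b n
  ≡⟨ cancel (⁺ b n) _ ⟩
    ⁺ a (suc (n / 2))
  ≡⟨ cong (λ k → ⁺ a k) (+-comm 1 (n / 2)) ⟩
    ⁺ a (n / 2 + 1) ∎
  where
  open ≡-Reasoning
  cancel : ∀ x y → x ℤ.+ y ℤ.- x ≡ y
  cancel = ℤ-solve-∀

⌊[n-1]²/4⌋ : ℕ → ℕ
⌊[n-1]²/4⌋ zero = 0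
⌊[n-1]²/4⌋ (suc k) = (k * k) / 4

⌊[n-1]²/4⌋-step : ∀ m → ⌊[n-1]²/4⌋ (2 + m) ≡ ⌊[n-1]²/4⌋ m + m
⌊[n-1]²/4⌋-step zero = refl
⌊[n-1]²/4⌋-step (suc k) = begin
    (suc (suc k) * suc (suc k)) / 4
  ≡⟨ cong (_/ 4) (expand k) ⟩
    (k * k + suc k * 4) / 4
  ≡⟨ +-distrib-/-∣ʳ (k * k) (divides (suc k) refl) ⟩
    (k * k) / 4 + (suc k * 4) / 4
  ≡⟨ cong ((k * k) / 4 +_) (m*n/n≡m (suc k) 4) ⟩
    (k * k) / 4 + suc k ∎
  where
  open ≡-Reasoning
  expand : ∀ k → (2 + k) * (2 + k) ≡ k * k + (1 + k) * 4
  expand = solve-∀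

⌊[n-1]²/4⌋≗G2⋆q²·id : ⌊[n-1]²/4⌋ ≗ geomInv 2 ⋆ q^ 2 · id
⌊[n-1]²/4⌋≗G2⋆q²·id = solve-geomInv 1 (q^ 2 · id) λ where
  zero → refl
  (suc zero) → refl
  (suc (suc m)) → trans (⌊[n-1]²/4⌋-step m) (+-comm _ m)

b≗⌊[n-1]²/4⌋⋆P⟨q²⟩ : b ≗ ⌊[n-1]²/4⌋ ⋆ P ⟨q²⟩
b≗⌊[n-1]²/4⌋⋆P⟨q²⟩ = begin
    b
  ≈⟨ b-generatingFunction ⟩
    q^ 3 · (ones ⋆ G2 ⋆ P)
  ≈⟨ q^·-cong 3 (⋆-congʳ (ones ⋆ G2) P-generatingFunction) ⟩
    q^ 3 · (ones ⋆ G2 ⋆ (ones ⋆ P ⟨q²⟩))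
  ≈⟨ q^·-cong 3 (solve 3 (λ o g p → (o ⊗ g) ⊗ (o ⊗ p) ⊜ (g ⊗ (o ⊗ o)) ⊗ p) ≗-refl ones G2 (P ⟨q²⟩)) ⟩
    q^ 3 · (G2 ⋆ (ones ⋆ ones) ⋆ P ⟨q²⟩)
  ≈⟨ ≗-trans (⋆-congˡ (P ⟨q²⟩) (⋆-q^·ʳ 3 G2 (ones ⋆ ones))) (⋆-q^·ˡ 3 (G2 ⋆ (ones ⋆ ones)) (P ⟨q²⟩)) ⟨
    G2 ⋆ q^ 3 · (ones ⋆ ones) ⋆ P ⟨q²⟩
  ≈⟨ ⋆-congˡ (P ⟨q²⟩) (⋆-congʳ G2 (≗-trans (≗-sym (q^·-q^· 2 1 _)) (q^·-cong 2 (≗-sym id≗q·ones⋆ones)))) ⟩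
    G2 ⋆ q^ 2 · id ⋆ P ⟨q²⟩
  ≈⟨ ⋆-congˡ (P ⟨q²⟩) ⌊[n-1]²/4⌋≗G2⋆q²·id ⟨
    ⌊[n-1]²/4⌋ ⋆ P ⟨q²⟩ ∎
  where
  open ≗-Reasoning
  G2 : Series
  G2 = geomInv 2

sqTerm≡⌊[n-1]²/4⌋ : ∀ n i → i + i ≤ n → sqTerm n i ≡ ⌊[n-1]²/4⌋ (n ∸ (i + i))
sqTerm≡⌊[n-1]²/4⌋ n i 2i≤n = trans (cong (λ d → (d * d) / 4) ∣n-1-2i∣≡) (square/4 (n ∸ (i + i)))
  where
  k : ℕ
  k = n ∸ (i + i)
  n≡k+2i : n ≡ k + 2 * i
  n≡k+2i = sym (trans (cong (k +_) (cong (i +_) (+-identityʳ i))) (m∸n+n≡m 2i≤n))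
  cancel : ∀ x y o → x ℤ.+ y ℤ.- o ℤ.- y ≡ x ℤ.- o
  cancel = ℤ-solve-∀
  ∣k-1∣ : ℕ → ℕ
  ∣k-1∣ zero = 1
  ∣k-1∣ (suc k) = k
  ∣n-1-2i∣≡ : ℤ.∣ ⁺ n ℤ.- ⁺ 1 ℤ.- ⁺ (2 * i) ∣ ≡ ∣k-1∣ k
  ∣n-1-2i∣≡ = begin
      ℤ.∣ ⁺ n ℤ.- ⁺ 1 ℤ.- ⁺ (2 * i) ∣
    ≡⟨ cong (λ x → ℤ.∣ ⁺ x ℤ.- ⁺ 1 ℤ.- ⁺ (2 * i) ∣) n≡k+2i ⟩
      ℤ.∣ ⁺ (k + 2 * i) ℤ.- ⁺ 1 ℤ.- ⁺ (2 * i) ∣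
    ≡⟨ cong ℤ.∣_∣
         (trans (cong (λ x → x ℤ.- ⁺ 1 ℤ.- ⁺ (2 * i)) (ℤ.pos-+ k (2 * i))) (cancel (⁺ k) (⁺ (2 * i)) (⁺ 1))) ⟩
      ℤ.∣ ⁺ k ℤ.- ⁺ 1 ∣
    ≡⟨ ∣⁺k-1∣ k ⟩
      ∣k-1∣ k ∎
    where
    open ≡-Reasoning
    ∣⁺k-1∣ : ∀ k → ℤ.∣ ⁺ k ℤ.- ⁺ 1 ∣ ≡ ∣k-1∣ k
    ∣⁺k-1∣ zero = refl
    ∣⁺k-1∣ (suc k) = refl
  square/4 : ∀ k → (∣k-1∣ k * ∣k-1∣ k) / 4 ≡ ⌊[n-1]²/4⌋ k
  square/4 zero = refl
  square/4 (suc k) = refl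

b[n]≡Σ⌊[n-1-2i]²/4⌋|B[i]| : ∀ n → b n ≡ Σ[ 0 ⋯ n / 2 ] (λ i → sqTerm n i * length (B i))
b[n]≡Σ⌊[n-1-2i]²/4⌋|B[i]| n = begin
    b n
  ≡⟨ b≗⌊[n-1]²/4⌋⋆P⟨q²⟩ n ⟩
    (⌊[n-1]²/4⌋ ⋆ P ⟨q²⟩) n
  ≡⟨ ⋆-comm ⌊[n-1]²/4⌋ (P ⟨q²⟩) n ⟩
    (P ⟨q²⟩ ⋆ ⌊[n-1]²/4⌋) n
  ≡⟨ ⟨q²⟩-⋆≗Σ P ⌊[n-1]²/4⌋ n ⟩
    Σ[ 0 ⋯ n / 2 ] (λ i → P i * ⌊[n-1]²/4⌋ (n ∸ (i + i)))
  ≡⟨ sum-upTo-cong (suc (n / 2)) (λ {i} i≤n/2 →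
       trans (*-comm (P i) _) (cong (_* P i) (sym (sqTerm≡⌊[n-1]²/4⌋ n i (2i≤n i≤n/2))))) ⟩
    Σ[ 0 ⋯ n / 2 ] (λ i → sqTerm n i * length (B i)) ∎
  where
  open ≡-Reasoning
  2i≤n : ∀ {i} → i < suc (n / 2) → i + i ≤ n
  2i≤n {i} (s≤s i≤n/2) = ≤-trans (+-mono-≤ i≤n/2 i≤n/2) (≤-trans (≤-reflexive (double (n / 2))) (m/n*n≤m n 2))
    where
    double : ∀ x → x + x ≡ x * 2
    double = solve-∀

β-term : ℕ → ℕ → ℕ
β-term k i = if does (2 ^ i ∣? k) then 2 ^ i else 0

β-term-zero : ∀ k → β-term k 0 ≡ 1
β-term-zero k = cong (if_then 1 else 0) (dec-true (1 ∣? k) (1∣ k))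

β-term-odd : ∀ j i → β-term (suc (j + j)) (suc i) ≡ 0
β-term-odd j i =
  cong (if_then 2 ^ suc i else 0) (dec-false (2 ^ suc i ∣? suc (j + j)) (2∤1+2j ∘ ∣-trans (m∣m*n (2 ^ i))))
  where
  2∤1+2j : ¬ 2 ∣ suc (j + j)
  2∤1+2j 2∣1+2j = contradiction
    (trans (sym ([m+kn]%n≡m%n 1 j 2))
      (n∣m⇒m%n≡0 _ 2 (subst (λ x → 2 ∣ suc x) (trans (j+j≡2*j j) (*-comm 2 j)) 2∣1+2j)))
    (λ ())

β-term-even : ∀ j i → β-term (j + j) (suc i) ≡ 2 * β-term j i
β-term-even j i = trans
  (cong (if_then 2 ^ suc i else 0) (does-⇔ (mk⇔ halve double) (2 ^ suc i ∣? (j + j)) (2 ^ i ∣? j)))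
  (scale (does (2 ^ i ∣? j)))
  where
  scale : ∀ b → (if b then 2 ^ suc i else 0) ≡ 2 * (if b then 2 ^ i else 0)
  scale true = refl
  scale false = refl
  halve : 2 * 2 ^ i ∣ j + j → 2 ^ i ∣ j
  halve = *-cancelˡ-∣ 2 ∘ subst (2 * 2 ^ i ∣_) (j+j≡2*j j)
  double : 2 ^ i ∣ j → 2 * 2 ^ i ∣ j + j
  double = subst (2 * 2 ^ i ∣_) (sym (j+j≡2*j j)) ∘ *-monoʳ-∣ 2

β-term-large : ∀ j i → 0 < j → j < 2 ^ i → β-term j i ≡ 0
β-term-large j i 0<j j<2^i = cong (if_then 2 ^ i else 0) (dec-false (2 ^ i ∣? j) (<⇒≱ j<2^i ∘ ∣⇒≤ {{>-nonZero 0<j}}))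

β-odd : ∀ j → β (suc (j + j)) ≡ 1
β-odd j = begin
    sum (map (β-term K) (upTo (suc K)))
  ≡⟨ sum-upTo-suc (β-term K) K ⟩
    β-term K 0 + sum (map (β-term K ∘ suc) (upTo K))
  ≡⟨ cong₂ _+_ (β-term-zero K) (trans (sum-upTo-cong K (λ {i} _ → β-term-odd j i)) (sum-upTo-* 0 (λ _ → 0) K)) ⟩
    1 ∎
  where
  open ≡-Reasoning
  K : ℕ
  K = suc (j + j)

β-even : ∀ j → 0 < j → β (j + j) ≡ 1 + 2 * β j
β-even j 0<j = begin
    sum (map (β-term (j + j)) (upTo (suc (j + j))))
  ≡⟨ sum-upTo-suc (β-term (j + j)) (j + j) ⟩
    β-term (j + j) 0 + sum (map (β-term (j + j) ∘ suc) (upTo (j + j)))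
  ≡⟨ cong₂ _+_ (β-term-zero (j + j)) (sum-upTo-cong (j + j) (λ {i} _ → β-term-even j i)) ⟩
    1 + sum (map (λ i → 2 * β-term j i) (upTo (j + j)))
  ≡⟨ cong (1 +_) (sum-upTo-* 2 (β-term j) (j + j)) ⟩
    1 + 2 * sum (map (β-term j) (upTo (j + j)))
  ≡⟨ cong (λ n → 1 + 2 * sum (map (β-term j) (upTo n)))
       (trans (sym (cong (j +_) (suc-pred j {{>-nonZero 0<j}}))) (+-suc j (pred j))) ⟩
    1 + 2 * sum (map (β-term j) (upTo (suc j + pred j)))
  ≡⟨ cong (λ x → 1 + 2 * x) (sum-upTo-truncate (β-term j) (suc j) (pred j) beyond-j) ⟩
    1 + 2 * β j ∎
  where
  open ≡-Reasoning
  beyond-j : ∀ i → β-term j (suc j + i) ≡ 0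
  beyond-j i = β-term-large j (suc j + i) 0<j (<-≤-trans (n<2^n j) (^-monoʳ-≤ 2 (≤-trans (n≤1+n j) (m≤m+n (suc j) i))))

-- β with constant term 0: the formula defining β gives β 0 = 1.
β₊ : Series
β₊ zero = 0
β₊ (suc k) = β (suc k)

β₊-fixpoint : β₊ ≗ q^ 1 · ones ⊕ 2 ⊙ β₊ ⟨q²⟩
β₊-fixpoint n with evenOdd n
... | even zero = refl
... | even (suc j) = trans (β-even (suc j) (s≤s z≤n)) (cong (λ x → 1 + 2 * x) (sym (⟨q²⟩-even β₊ (suc j))))
... | odd j = trans (β-odd j) (cong (λ x → 1 + 2 * x) (sym (⟨q²⟩-odd β₊ j)))

θ-ones : θ ones ≗ q^ 1 · ones ⋆ ones
θ-ones n = trans (*-identityʳ n) (trans (id≗q·ones⋆ones n) (sym (⋆-q^·ˡ 1 ones ones n)))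

θP-fixpoint : θ P ≗ q^ 1 · ones ⋆ P ⊕ 2 ⊙ (ones ⋆ θ P ⟨q²⟩)
θP-fixpoint = begin
    θ P
  ≈⟨ θ-cong P-generatingFunction ⟩
    θ (ones ⋆ P ⟨q²⟩)
  ≈⟨ θ-⋆ ones (P ⟨q²⟩) ⟩
    θ ones ⋆ P ⟨q²⟩ ⊕ ones ⋆ θ (P ⟨q²⟩)
  ≈⟨ (λ n → cong₂ _+_ (⋆-congˡ (P ⟨q²⟩) θ-ones n) (⋆-congʳ ones (θ-⟨q²⟩ P) n)) ⟩
    q^ 1 · ones ⋆ ones ⋆ P ⟨q²⟩ ⊕ ones ⋆ (2 ⊙ θ P ⟨q²⟩)
  ≈⟨ (λ n → cong₂ _+_ (trans (⋆-assoc (q^ 1 · ones) ones _ n) (⋆-congʳ (q^ 1 · ones) (≗-sym P-generatingFunction) n))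
                      (⋆-⊙ʳ 2 ones (θ P ⟨q²⟩) n)) ⟩
    q^ 1 · ones ⋆ P ⊕ 2 ⊙ (ones ⋆ θ P ⟨q²⟩) ∎
  where open ≗-Reasoning

β₊⋆P-fixpoint : β₊ ⋆ P ≗ q^ 1 · ones ⋆ P ⊕ 2 ⊙ (ones ⋆ (β₊ ⋆ P) ⟨q²⟩)
β₊⋆P-fixpoint = begin
    β₊ ⋆ P
  ≈⟨ ⋆-congˡ P β₊-fixpoint ⟩
    (q^ 1 · ones ⊕ 2 ⊙ β₊ ⟨q²⟩) ⋆ P
  ≈⟨ ⋆-distribʳ-⊕ (q^ 1 · ones) _ P ⟩
    q^ 1 · ones ⋆ P ⊕ (2 ⊙ β₊ ⟨q²⟩) ⋆ P
  ≈⟨ (λ n → cong ((q^ 1 · ones ⋆ P) n +_) (⋆-⊙ˡ 2 (β₊ ⟨q²⟩) P n)) ⟩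
    q^ 1 · ones ⋆ P ⊕ 2 ⊙ (β₊ ⟨q²⟩ ⋆ P)
  ≈⟨ (λ n → cong (λ x → (q^ 1 · ones ⋆ P) n + 2 * x) (rearrange n)) ⟩
    q^ 1 · ones ⋆ P ⊕ 2 ⊙ (ones ⋆ (β₊ ⋆ P) ⟨q²⟩) ∎
  where
  open ≗-Reasoning
  rearrange : β₊ ⟨q²⟩ ⋆ P ≗ ones ⋆ (β₊ ⋆ P) ⟨q²⟩
  rearrange = ≗-trans (⋆-congʳ (β₊ ⟨q²⟩) P-generatingFunction)
    (≗-trans (solve 3 (λ β o p → β ⊗ (o ⊗ p) ⊜ o ⊗ (β ⊗ p)) ≗-refl (β₊ ⟨q²⟩) ones (P ⟨q²⟩))
      (⋆-congʳ ones (≗-sym (⟨q²⟩-⋆ β₊ P))))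

θP≗β₊⋆P : θ P ≗ β₊ ⋆ P
θP≗β₊⋆P = ⟨q²⟩-fixpoint-unique (q^ 1 · ones ⋆ P) θP-fixpoint β₊⋆P-fixpoint

L : Series
L = q^ 1 · ones ⊕ 2 ⊙ q^ 2 · geomInv 2 ⊕ β₊

b/q³ : Series
b/q³ = ones ⋆ (geomInv 2 ⋆ P)

b≗q³·b/q³ : b ≗ q^ 3 · b/q³
b≗q³·b/q³ = ≗-trans b-generatingFunction (q^·-cong 3 (⋆-assoc ones (geomInv 2) P))

-- L is the logarithmic derivative θY/Y of Y = P/((1 - q)(1 - q²)), one summand per factor.
θ-b/q³ : θ b/q³ ≗ L ⋆ b/q³
θ-b/q³ = begin
    θ (ones ⋆ (G2 ⋆ P))
  ≈⟨ θ-⋆ ones (G2 ⋆ P) ⟩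
    θ ones ⋆ (G2 ⋆ P) ⊕ ones ⋆ θ (G2 ⋆ P)
  ≈⟨ (λ n → cong₂ _+_ (⋆-congˡ (G2 ⋆ P) θ-ones n) (⋆-congʳ ones (θ-⋆ G2 P) n)) ⟩
    q^ 1 · ones ⋆ ones ⋆ (G2 ⋆ P) ⊕ ones ⋆ (θ G2 ⋆ P ⊕ G2 ⋆ θ P)
  ≈⟨ (λ n → cong₂ _+_ (⋆-assoc (q^ 1 · ones) ones _ n)
       (⋆-congʳ ones (λ k → cong₂ _+_ (⋆-congˡ P θG2 k) (⋆-congʳ G2 θP≗β₊⋆P k)) n)) ⟩
    q^ 1 · ones ⋆ b/q³ ⊕ ones ⋆ ((2 ⊙ q^ 2 · G2) ⋆ G2 ⋆ P ⊕ G2 ⋆ (β₊ ⋆ P))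
  ≈⟨ (λ n → cong ((q^ 1 · ones ⋆ b/q³) n +_) (trans (⋆-distribˡ-⊕ ones _ _ n)
       (cong₂ _+_ (solve 4 (λ o ℓ g p → o ⊗ ((ℓ ⊗ g) ⊗ p) ⊜ ℓ ⊗ (o ⊗ (g ⊗ p))) ≗-refl ones (2 ⊙ q^ 2 · G2) G2 P n)
                  (solve 4 (λ o g β p → o ⊗ (g ⊗ (β ⊗ p)) ⊜ β ⊗ (o ⊗ (g ⊗ p))) ≗-refl ones G2 β₊ P n)))) ⟩
    q^ 1 · ones ⋆ b/q³ ⊕ ((2 ⊙ q^ 2 · G2) ⋆ b/q³ ⊕ β₊ ⋆ b/q³)
  ≈⟨ (λ n → trans (sym (+-assoc ((q^ 1 · ones ⋆ b/q³) n) _ _))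
       (sym (trans (⋆-distribʳ-⊕ (q^ 1 · ones ⊕ 2 ⊙ q^ 2 · G2) β₊ b/q³ n)
                   (cong (_+ (β₊ ⋆ b/q³) n) (⋆-distribʳ-⊕ (q^ 1 · ones) (2 ⊙ q^ 2 · G2) b/q³ n))))) ⟩
    L ⋆ b/q³ ∎
  where
  open ≗-Reasoning
  G2 : Series
  G2 = geomInv 2
  θG2 : θ G2 ≗ 2 ⊙ q^ 2 · G2 ⋆ G2
  θG2 = ≗-trans (θ-geomInv 1) (⋆-comm G2 _)

θb≗L⋆b+3b : θ b ≗ L ⋆ b ⊕ 3 ⊙ b
θb≗L⋆b+3b = begin
    θ b
  ≈⟨ θ-cong b≗q³·b/q³ ⟩
    θ (q^ 3 · b/q³)
  ≈⟨ θ-q^· 3 b/q³ ⟩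
    q^ 3 · θ b/q³ ⊕ 3 ⊙ q^ 3 · b/q³
  ≈⟨ (λ n → cong₂ _+_ (q^·-cong 3 θ-b/q³ n) (cong (3 *_) (sym (b≗q³·b/q³ n)))) ⟩
    q^ 3 · (L ⋆ b/q³) ⊕ 3 ⊙ b
  ≈⟨ (λ n → cong (_+ 3 * b n) (trans (sym (⋆-q^·ʳ 3 L b/q³ n)) (⋆-congʳ L (≗-sym b≗q³·b/q³) n))) ⟩
    L ⋆ b ⊕ 3 ⊙ b ∎
  where open ≗-Reasoning

L⋆≗Σ : ∀ f n → (L ⋆ f) n ≡ sum (map (λ k → L (suc k) * f (n ∸ suc k)) (upTo n))
L⋆≗Σ f zero = refl
L⋆≗Σ f (suc n) = ⋆≗Σ (tail L) f n

L≡β+sgn+2 : ∀ k → ⁺ L (suc k) ≡ ⁺ β (suc k) ℤ.+ sgn (suc k) ℤ.+ ⁺ 2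
L≡β+sgn+2 k = trans (cong (λ x → ⁺ (1 + 2 * x + β (suc k))) (q²·G2≡G2 k)) (by-parity (does (2 ∣? suc k)))
  where
  q²·G2≡G2 : ∀ k → (q^ 2 · geomInv 2) (suc k) ≡ geomInv 2 (suc k)
  q²·G2≡G2 zero = sym (geomInv-< 2 (s≤s z≤n) ≤-refl)
  q²·G2≡G2 (suc k) = sym (geomInv-periodic 2 k)
  by-parity : ∀ even? → ⁺ (1 + 2 * (if even? then 1 else 0) + β (suc k))
                         ≡ ⁺ β (suc k) ℤ.+ (if even? then ⁺ 1 else ℤ.- ⁺ 1) ℤ.+ ⁺ 2
  by-parity true = cong ⁺_ (trans (+-comm 3 (β (suc k))) (sym (+-assoc (β (suc k)) 1 2)))
  by-parity false = trans (cong ⁺_ (+-comm 1 (β (suc k)))) (rearrange (⁺ β (suc k)))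
    where
    rearrange : ∀ x → x ℤ.+ ⁺ 1 ≡ x ℤ.+ ℤ.- ⁺ 1 ℤ.+ ⁺ 2
    rearrange = ℤ-solve-∀

[n-3]b[n]≡Σ[β+sgn+2]b[n-k] :
  ∀ n → (⁺ n ℤ.- ⁺ 3) ℤ.* ⁺ b n ≡ Σℤ[ 1 ⋯ n ] (λ k → (⁺ β k ℤ.+ sgn k ℤ.+ ⁺ 2) ℤ.* ⁺ b (n ∸ k))
[n-3]b[n]≡Σ[β+sgn+2]b[n-k] n = begin
    (⁺ n ℤ.- ⁺ 3) ℤ.* ⁺ b n
  ≡⟨ distrib (⁺ n) (⁺ 3) (⁺ b n) ⟩
    ⁺ n ℤ.* ⁺ b n ℤ.- ⁺ 3 ℤ.* ⁺ b n
  ≡⟨ cong (λ x → x ℤ.- ⁺ 3 ℤ.* ⁺ b n) (trans (sym (ℤ.pos-* n (b n))) (cong ⁺_ (θb≗L⋆b+3b n))) ⟩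
    ⁺ ((L ⋆ b) n + 3 * b n) ℤ.- ⁺ 3 ℤ.* ⁺ b n
  ≡⟨ cong (ℤ._- ⁺ 3 ℤ.* ⁺ b n)
       (trans (ℤ.pos-+ ((L ⋆ b) n) (3 * b n)) (cong (ℤ._+_ (⁺ (L ⋆ b) n)) (ℤ.pos-* 3 (b n)))) ⟩
    ⁺ (L ⋆ b) n ℤ.+ ⁺ 3 ℤ.* ⁺ b n ℤ.- ⁺ 3 ℤ.* ⁺ b n
  ≡⟨ cancel (⁺ (L ⋆ b) n) (⁺ 3 ℤ.* ⁺ b n) ⟩
    ⁺ (L ⋆ b) n
  ≡⟨ cong ⁺_ (L⋆≗Σ b n) ⟩
    ⁺ sum (map (λ k → L (suc k) * b (n ∸ suc k)) (upTo n))
  ≡⟨ ⁺-sum (λ k → L (suc k) * b (n ∸ suc k)) (upTo n) ⟩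
    foldr ℤ._+_ (⁺ 0) (map (λ k → ⁺ (L (suc k) * b (n ∸ suc k))) (upTo n))
  ≡⟨ cong (foldr ℤ._+_ (⁺ 0))
       (map-cong (λ k → trans (ℤ.pos-* (L (suc k)) _) (cong (ℤ._* ⁺ b (n ∸ suc k)) (L≡β+sgn+2 k))) (upTo n)) ⟩
    Σℤ[ 1 ⋯ n ] (λ k → (⁺ β k ℤ.+ sgn k ℤ.+ ⁺ 2) ℤ.* ⁺ b (n ∸ k)) ∎
  where
  open ≡-Reasoning
  distrib : ∀ x y z → (x ℤ.- y) ℤ.* z ≡ x ℤ.* z ℤ.- y ℤ.* z
  distrib = ℤ-solve-∀
  cancel : ∀ x y → x ℤ.+ y ℤ.- y ≡ x
  cancel = ℤ-solve-∀

theorem2p4 : (∀ n → b n ≡ rhsA n)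
    × (∀ n → b n ≡ Σ[ 1 ⋯ n ] (λ i → ((i ∸ 1) / 2) * length (B (n ∸ i))))
    × (∀ n → b n ≡ Σ[ 0 ⋯ n / 2 ] (λ i → sqTerm n i * length (B i)))
    × (∀ n → (⁺ n ℤ.- ⁺ 3) ℤ.* ⁺ b n
               ≡ Σℤ[ 1 ⋯ n ] (λ k → (⁺ β k ℤ.+ sgn k ℤ.+ ⁺ 2) ℤ.* ⁺ b (n ∸ k)))
    × (∀ n → ⁺ b (suc n) ℤ.- ⁺ b n ≡ ⁺ a (n / 2 + 1))
    × (∀ n → a n ≡ b n + b (suc n))
theorem2p4 =
    b≗rhsA
  , b[n]≡Σ⌊[i-1]/2⌋|B[n-i]|
  , b[n]≡Σ⌊[n-1-2i]²/4⌋|B[i]|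
  , [n-3]b[n]≡Σ[β+sgn+2]b[n-k]
  , b[n+1]-b[n]≡a[n/2+1]
  , a[n]≡b[n]+b[n+1]
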